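{- Let $d$ be a prime greater than $2$ and let $Z\subset\mathbb{R}^d$ be the zonotope generated by the $d+1$ vectors $$\mathbf{u}_i=\mathbf{e}_i\ (i=1,\dots,d-1),\qquad \mathbf{u}_d=-\sum_{i=1}^{d-1}\mathbf{e}_i,\qquad \mathbf{v}=\mathbf{e}_d,$$ of which only $\mathbf{v}$ is a coloop. Let $\Lambda=\mathbb{Z}^d+\mathbb{Z}\cdot\frac1d(1,2,\dots,d-1,1)$. Then, with respect to the lattice $\Lambda$, $Z$ has lattice width at least three and $\kappa(Z)=\frac{d-1}{d}>\frac{d}{d+2}$.
   Context: The zonotope generated by a configuration $U$ is $\sum_{\mathbf{u}\in U}[\mathbf{0},\mathbf{u}]$, with center $\mathbf{c}=\frac12\sum_{\mathbf{u}\in U}\mathbf{u}$. A generator $\mathbf{u}$ is a coloop if all the other generators lie in a common linear hyperplane. With respect to a lattice $\Lambda$: the lattice width of a convex body $C$ is the minimum over nonzero linear functionals $f$ with $f(\Lambda)\subseteq\mathbb{Z}$ of $\max_C f-\min_C f$; and $\kappa(Z)$ is the minimum $\lambda\ge0$ such that $\mathbf{c}+\lambda(Z-\mathbf{c})$ contains a point of $\Lambda$.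
   Formalization: Points of Z, the linear functionals f defining lattice width, the factors λ in κ(Z) and the hyperplane normals in the coloop condition are taken over ℚ instead of ℝ. -}

module Defs where

open import Data.Nat as ℕ using (ℕ; zero; suc; _∸_; NonZero)
open import Data.Nat.Properties using (_<?_; _≟_)
open import Data.Integer using (ℤ; +_; -[1+_])
open import Data.Rational using (ℚ; _+_; _*_; _-_; -_; _≤_; _<_; _/_; 0ℚ; 1ℚ; ½)
open import Data.Fin using (Fin; toℕ)
import Data.Fin as Fin
open import Data.Product using (Σ; ∃; _×_)
open import Relation.Binary.PropositionalEquality using (_≡_; _≢_)
open import Relation.Nullary using (¬_; yes; no)

Vecℚ : ℕ → Set
Vecℚ d = Fin d → ℚ

sumFin : ∀ {m} → (Fin m → ℚ) → ℚ
sumFin {zero}  f = 0ℚ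
sumFin {suc m} f = f Fin.zero + sumFin (λ i → f (Fin.suc i))

dot : ∀ {d} → Vecℚ d → Vecℚ d → ℚ
dot f x = sumFin (λ j → f j * x j)

InZonotope : ∀ {m d} → (Fin m → Vecℚ d) → Vecℚ d → Set
InZonotope {m} U x =
  Σ (Fin m → ℚ) λ t → (∀ i → 0ℚ ≤ t i × t i ≤ 1ℚ) × (∀ j → x j ≡ sumFin (λ i → t i * U i j))

center : ∀ {m d} → (Fin m → Vecℚ d) → Vecℚ d
center U j = ½ * sumFin (λ i → U i j)

InScaled : ∀ {m d} → (Fin m → Vecℚ d) → ℚ → Vecℚ d → Set
InScaled U λ' x =
  Σ (Vecℚ _) λ y → InZonotope U y × (∀ j → x j ≡ center U j + λ' * (y j - center U j))

-- u_k is a coloop: all other generators lie in a common linear hyperplane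
IsColoop : ∀ {m d} → (Fin m → Vecℚ d) → Fin m → Set
IsColoop {m} {d} U k =
  Σ (Vecℚ d) λ g → (∃ λ j → g j ≢ 0ℚ) × (∀ i → i ≢ k → dot g (U i) ≡ 0ℚ)

Lattice : ℕ → Set₁
Lattice d = Vecℚ d → Set

IntegralOn : ∀ {d} → Lattice d → Vecℚ d → Set
IntegralOn L f = ∀ x → L x → ∃ λ (z : ℤ) → dot f x ≡ z / 1

LatticeWidthAtLeast : ∀ {m d} → Lattice d → (Fin m → Vecℚ d) → ℚ → Set
LatticeWidthAtLeast {m} {d} L U w =
  ∀ (f : Vecℚ d) → (∃ λ j → f j ≢ 0ℚ) → IntegralOn L f →
    Σ (Vecℚ d) λ x → Σ (Vecℚ d) λ y →
      InZonotope U x × InZonotope U y × w ≤ dot f x - dot f y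

IsKappa : ∀ {m d} → Lattice d → (Fin m → Vecℚ d) → ℚ → Set
IsKappa {m} {d} L U k =
  0ℚ ≤ k
  × (Σ (Vecℚ d) λ x → L x × InScaled U k x)
  × (∀ λ' → 0ℚ ≤ λ' → λ' < k → ¬ (Σ (Vecℚ d) λ x → L x × InScaled U λ' x))

-- The d+1 generators (0-based): index k < d-1 : e_k ; index d-1 : -(e_0+…+e_{d-2}) ;
-- index d : v = e_{d-1} (last coordinate).
gens : (d : ℕ) → Fin (suc d) → Vecℚ d
gens d k j with toℕ k <? d ∸ 1
... | yes _ with toℕ j ≟ toℕ k
...   | yes _ = 1ℚ
...   | no  _ = 0ℚ
gens d k j | no _ with toℕ k ≟ d ∸ 1
...   | yes _ with toℕ j <? d ∸ 1
...     | yes _ = - 1ℚ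
...     | no  _ = 0ℚ
gens d k j | no _ | no _ with toℕ j ≟ d ∸ 1
...     | yes _ = 1ℚ
...     | no  _ = 0ℚ

wvec : (d : ℕ) → .{{NonZero d}} → Vecℚ d
wvec d j with toℕ j <? d ∸ 1
... | yes _ = + suc (toℕ j) / d
... | no  _ = + 1 / d

Λ : (d : ℕ) → .{{NonZero d}} → Lattice d
Λ d x = Σ (Fin d → ℤ) λ z → Σ ℤ λ n → ∀ j → x j ≡ z j / 1 + (n / 1) * wvec d j

-- A functional f attains on Z the width Σₖ |f(uₖ)|, between the vertices Σ_{f(uₖ)>0} uₖ and
-- Σ_{f(uₖ)<0} uₖ. For f integral on Λ the values cₖ = f(uₖ) are integers, and two relations hold:
-- u₁ + … + u_d = 0 gives c₁ + … + c_d = 0, and d·w = Σₖ ωₖ uₖ with ω = (1, …, d−1, 0, 1) gives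
-- d ∣ Σₖ ωₖ cₖ. Since ω₁, …, ω_d are distinct mod d, a nonzero such c has Σ |cₖ| ≥ 3: otherwise
-- (c₁, …, c_d) = e_p − e_q and c_v = 0, so d ∣ ω_p − ω_q. The same relation u₁ + … + u_d = 0 shows
-- that a functional vanishing on all generators but one u_k (k ≤ d) vanishes on all of them, so
-- only v is a coloop.
--
-- The lattice point w lies in c + ((d−1)/d)(Z − c). Conversely, let x = z + n w lie in c + λ(Z − c)
-- with λ < (d−1)/d. The d integers d·x₁, …, d·x_{d−1}, 0 lie in an interval of length
-- d λ < d − 1, so two coincide; as the weights are distinct mod the prime d this forces d ∣ n,
-- and then x_d = z_d + n/d is an integer strictly between 0 and 1.

module Submission where

open import Algebra.Bundles using (CommutativeMonoid; CommutativeRing)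
open import Data.Empty using (⊥)
open import Data.Fin as Fin using (Fin; zero; suc; toℕ; inject₁; fromℕ; punchIn; punchOut)
import Data.Fin.Properties as Fin
open import Data.Fin.Relation.Unary.Top using (view; view-fromℕ; view-inject₁; ‵fromℕ; ‵inject₁)
open import Data.Integer as ℤ using (ℤ; +_; -[1+_]; +[1+_])
open import Data.Integer.Divisibility.Signed using (_∣_; divides; ∣⇒∣ᵤ; ∣ᵤ⇒∣)
import Data.Integer.Properties as ℤ
open import Data.Integer.Solver using () renaming (module +-*-Solver to ℤ-Solver)
open import Data.Nat as ℕ using (ℕ; zero; suc; z≤n; s≤s; _∸_; _<_; NonZero)
import Data.Nat.Coprimality as Coprimality
import Data.Nat.Divisibility as ℕ
open import Data.Nat.Primality using (Prime; euclidsLemma)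
import Data.Nat.Properties as ℕ
open import Data.Nat.Properties using (_<?_; _≟_)
open import Data.Nat.Solver using () renaming (module +-*-Solver to ℕ-Solver)
open import Data.Product using (_×_; _,_; Σ; ∃; proj₁; proj₂; map₂)
open import Data.Rational as ℚ using (ℚ; mkℚ; _/_; 0ℚ; 1ℚ; ½; *≤*; *<*)
import Data.Rational.Properties as ℚ
open import Data.Rational.Solver using () renaming (module +-*-Solver to ℚ-Solver)
import Data.Rational.Unnormalised as ℚᵘ
import Data.Rational.Unnormalised.Properties as ℚᵘ
open import Data.Sum using (_⊎_; inj₁; inj₂; [_,_]′)
open import Data.Vec.Functional using (Vector; removeAt; init; last)
open import Function using (_∘_)
open import Function.Bundles using (_⇔_; mk⇔)
open import Relation.Binary.PropositionalEquality
open import Relation.Nullary using (¬_; yes; no; contradiction)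
open import Algebra.Properties.Group ℚ.+-0-group using (identityˡ-unique)

open import Defs

-- Finite sums

without₂ : ∀ {a} {A : Set a} {n} (g : Vector A (suc (suc n))) {i j} → i ≢ j → Vector A n
without₂ g {i} i≢j = removeAt (removeAt g i) (punchOut i≢j)

module FiniteSums {c ℓ} (M : CommutativeMonoid c ℓ) where

  open CommutativeMonoid M using (Carrier; _≈_; ∙-congˡ; identityʳ)
    renaming (_∙_ to _+_; ε to 0#; setoid to ≈-setoid; trans to ≈-trans)
  open import Algebra.Properties.CommutativeMonoid.Sum M public
  open import Relation.Binary.Reasoning.Setoid ≈-setoid

  sum-zero : ∀ {n} (g : Vector Carrier n) → (∀ i → g i ≈ 0#) → sum g ≈ 0#
  sum-zero {n} g g≈0 = ≈-trans (sum-cong-≋ g≈0) (sum-replicate-zero n)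

  sum-δ : ∀ {n} (g : Vector Carrier n) i → (∀ j → j ≢ i → g j ≈ 0#) → sum g ≈ g i
  sum-δ {suc n} g i g≈0 = begin
    sum g                     ≈⟨ sum-remove g ⟩
    g i + sum (removeAt g i)  ≈⟨ ∙-congˡ (sum-zero _ (λ j → g≈0 _ (Fin.punchInᵢ≢i i j))) ⟩
    g i + 0#                  ≈⟨ identityʳ (g i) ⟩
    g i                       ∎

  sum-remove₂ : ∀ {n} (g : Vector Carrier (suc (suc n))) {i j} (i≢j : i ≢ j) →
                sum g ≈ g i + (g j + sum (without₂ g i≢j))
  sum-remove₂ g {i} {j} i≢j = begin
    sum g                                                        ≈⟨ sum-remove g ⟩
    g i + sum (removeAt g i)                                     ≈⟨ ∙-congˡ (sum-remove (removeAt g i)) ⟩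
    g i + (g (punchIn i (punchOut i≢j)) + sum (without₂ g i≢j))
      ≡⟨ cong (λ k → g i + (g k + sum (without₂ g i≢j))) (Fin.punchIn-punchOut i≢j) ⟩
    g i + (g j + sum (without₂ g i≢j))                           ∎

  sum-δ₂ : ∀ {n} (g : Vector Carrier (suc (suc n))) {i j} → i ≢ j →
           (∀ k → k ≢ i → k ≢ j → g k ≈ 0#) → sum g ≈ g i + g j
  sum-δ₂ g {i} {j} i≢j g≈0 = begin
    sum g                                ≈⟨ sum-remove₂ g i≢j ⟩
    g i + (g j + sum (without₂ g i≢j))   ≈⟨ ∙-congˡ (∙-congˡ (sum-zero (without₂ g i≢j) rest≈0)) ⟩
    g i + (g j + 0#)                     ≈⟨ ∙-congˡ (identityʳ (g j)) ⟩
    g i + g j                            ∎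
    where
    rest≈0 : ∀ k → without₂ g i≢j k ≈ 0#
    rest≈0 k = g≈0 _ (Fin.punchInᵢ≢i i _)
      (λ eq → Fin.punchInᵢ≢i (punchOut i≢j) k
        (Fin.punchIn-injective i _ _ (trans eq (sym (Fin.punchIn-punchOut i≢j)))))

module Σℚ = FiniteSums ℚ.+-0-commutativeMonoid
module Σℤ = FiniteSums ℤ.+-0-commutativeMonoid
module Σℕ = FiniteSums ℕ.+-0-commutativeMonoid
open import Algebra.Properties.Semiring.Sum (CommutativeRing.semiring ℚ.+-*-commutativeRing)
  using (*-distribˡ-sum)

sumFin≡sum : ∀ {n} (f : Fin n → ℚ) → sumFin f ≡ Σℚ.sum f
sumFin≡sum {zero}  f = refl
sumFin≡sum {suc n} f = cong (f zero ℚ.+_) (sumFin≡sum (f ∘ suc))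

sum-sub : ∀ {n} (f g : Fin n → ℚ) → Σℚ.sum (λ k → f k ℚ.- g k) ≡ Σℚ.sum f ℚ.- Σℚ.sum g
sum-sub {zero}  f g = refl
sum-sub {suc n} f g = begin
  (f zero ℚ.- g zero) ℚ.+ Σℚ.sum (λ k → f (suc k) ℚ.- g (suc k))
    ≡⟨ cong ((f zero ℚ.- g zero) ℚ.+_) (sum-sub (f ∘ suc) (g ∘ suc)) ⟩
  (f zero ℚ.- g zero) ℚ.+ (Σℚ.sum (f ∘ suc) ℚ.- Σℚ.sum (g ∘ suc))
    ≡⟨ solve 4 (λ a b x y → (a :- b) :+ (x :- y) := (a :+ x) :- (b :+ y)) refl
               (f zero) (g zero) (Σℚ.sum (f ∘ suc)) (Σℚ.sum (g ∘ suc)) ⟩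
  (f zero ℚ.+ Σℚ.sum (f ∘ suc)) ℚ.- (g zero ℚ.+ Σℚ.sum (g ∘ suc))
    ∎
  where
  open ≡-Reasoning
  open ℚ-Solver

sum≡0⇒≡0 : ∀ {n} (g : Fin n → ℕ) → Σℕ.sum g ≡ 0 → ∀ k → g k ≡ 0
sum≡0⇒≡0 {suc n} g Σg≡0 k = ℕ.m+n≡0⇒m≡0 (g k) (trans (sym (Σℕ.sum-remove g)) Σg≡0)

sum-≤0 : ∀ {n} (c : Fin n → ℤ) → (∀ k → c k ℤ.≤ + 0) → Σℤ.sum c ℤ.≤ + 0
sum-≤0 {zero}  c _   = ℤ.≤-refl
sum-≤0 {suc n} c c≤0 = ℤ.+-mono-≤ (c≤0 zero) (sum-≤0 (c ∘ suc) (c≤0 ∘ suc))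

sum-neg : ∀ {n} (c : Fin n → ℤ) → Σℤ.sum (λ k → ℤ.- c k) ≡ ℤ.- Σℤ.sum c
sum-neg {zero}  c = refl
sum-neg {suc n} c =
  trans (cong (ℤ._+_ (ℤ.- c zero)) (sum-neg (c ∘ suc))) (sym (ℤ.neg-distrib-+ (c zero) (Σℤ.sum (c ∘ suc))))

combination : ∀ {m d} → (Fin m → ℚ) → (Fin m → Vecℚ d) → Vecℚ d
combination t U j = sumFin (λ i → t i ℚ.* U i j)

dot≡sum : ∀ {d} (g u : Vecℚ d) → dot g u ≡ Σℚ.sum (λ j → g j ℚ.* u j)
dot≡sum g u = sumFin≡sum (λ j → g j ℚ.* u j)

dot-congʳ : ∀ {d} (g : Vecℚ d) {u v : Vecℚ d} → (∀ j → u j ≡ v j) → dot g u ≡ dot g v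
dot-congʳ g {u} {v} u≗v = begin
  dot g u                     ≡⟨ dot≡sum g u ⟩
  Σℚ.sum (λ j → g j ℚ.* u j)  ≡⟨ Σℚ.sum-cong-≗ (λ j → cong (g j ℚ.*_) (u≗v j)) ⟩
  Σℚ.sum (λ j → g j ℚ.* v j)  ≡⟨ dot≡sum g v ⟨
  dot g v                     ∎
  where open ≡-Reasoning

dot-comm : ∀ {d} (g u : Vecℚ d) → dot g u ≡ dot u g
dot-comm g u = trans (dot≡sum g u) (trans (Σℚ.sum-cong-≗ (λ j → ℚ.*-comm (g j) (u j))) (sym (dot≡sum u g)))

dot-scaleʳ : ∀ {d} (g : Vecℚ d) a (u : Vecℚ d) → dot g (λ j → a ℚ.* u j) ≡ a ℚ.* dot g u
dot-scaleʳ g a u = begin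
  dot g (λ j → a ℚ.* u j)             ≡⟨ dot≡sum g (λ j → a ℚ.* u j) ⟩
  Σℚ.sum (λ j → g j ℚ.* (a ℚ.* u j))  ≡⟨ Σℚ.sum-cong-≗ (λ j → trans (ℚ.*-comm (g j) _) (ℚ.*-assoc a (u j) (g j))) ⟩
  Σℚ.sum (λ j → a ℚ.* (u j ℚ.* g j))  ≡⟨ *-distribˡ-sum a (λ j → u j ℚ.* g j) ⟨
  a ℚ.* Σℚ.sum (λ j → u j ℚ.* g j)    ≡⟨ cong (a ℚ.*_) (Σℚ.sum-cong-≗ (λ j → ℚ.*-comm (u j) (g j))) ⟩
  a ℚ.* Σℚ.sum (λ j → g j ℚ.* u j)    ≡⟨ cong (a ℚ.*_) (dot≡sum g u) ⟨
  a ℚ.* dot g u                       ∎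
  where open ≡-Reasoning

dot-combination : ∀ {m d} (g : Vecℚ d) (t : Fin m → ℚ) (U : Fin m → Vecℚ d) →
                  dot g (combination t U) ≡ sumFin (λ i → t i ℚ.* dot g (U i))
dot-combination g t U = begin
  dot g (combination t U)
    ≡⟨ dot≡sum g (combination t U) ⟩
  Σℚ.sum (λ j → g j ℚ.* combination t U j)
    ≡⟨ Σℚ.sum-cong-≗ (λ j → cong (g j ℚ.*_) (sumFin≡sum (λ i → t i ℚ.* U i j))) ⟩
  Σℚ.sum (λ j → g j ℚ.* Σℚ.sum (λ i → t i ℚ.* U i j))
    ≡⟨ Σℚ.sum-cong-≗ (λ j → *-distribˡ-sum (g j) (λ i → t i ℚ.* U i j)) ⟩
  Σℚ.sum (λ j → Σℚ.sum (λ i → g j ℚ.* (t i ℚ.* U i j)))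
    ≡⟨ Σℚ.∑-comm (λ j i → g j ℚ.* (t i ℚ.* U i j)) ⟩
  Σℚ.sum (λ i → Σℚ.sum (λ j → g j ℚ.* (t i ℚ.* U i j)))
    ≡⟨ Σℚ.sum-cong-≗ (λ i → Σℚ.sum-cong-≗ (λ j → swap (g j) (t i) (U i j))) ⟩
  Σℚ.sum (λ i → Σℚ.sum (λ j → t i ℚ.* (g j ℚ.* U i j)))
    ≡⟨ Σℚ.sum-cong-≗ (λ i → *-distribˡ-sum (t i) (λ j → g j ℚ.* U i j)) ⟨
  Σℚ.sum (λ i → t i ℚ.* Σℚ.sum (λ j → g j ℚ.* U i j))
    ≡⟨ Σℚ.sum-cong-≗ (λ i → cong (t i ℚ.*_) (dot≡sum g (U i))) ⟨
  Σℚ.sum (λ i → t i ℚ.* dot g (U i))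
    ≡⟨ sumFin≡sum (λ i → t i ℚ.* dot g (U i)) ⟨
  sumFin (λ i → t i ℚ.* dot g (U i))
    ∎
  where
  open ≡-Reasoning
  swap : ∀ x y z → x ℚ.* (y ℚ.* z) ≡ y ℚ.* (x ℚ.* z)
  swap x y z = trans (sym (ℚ.*-assoc x y z)) (trans (cong (ℚ._* z) (ℚ.*-comm x y)) (ℚ.*-assoc y x z))

-- Arithmetic in ℤ and ℚ

/1≡mkℚ : ∀ z → z / 1 ≡ mkℚ z 0 (Coprimality.sym (Coprimality.1-coprimeTo ℤ.∣ z ∣))
/1≡mkℚ (+ n)    = ℚ.normalize-coprime (Coprimality.sym (Coprimality.1-coprimeTo n))
/1≡mkℚ -[1+ n ] = cong ℚ.-_ (ℚ.normalize-coprime (Coprimality.sym (Coprimality.1-coprimeTo (suc n))))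

/1-+ : ∀ a b → (a ℤ.+ b) / 1 ≡ a / 1 ℚ.+ b / 1
/1-+ a b rewrite /1≡mkℚ a | /1≡mkℚ b =
  cong (_/ 1) (sym (cong₂ ℤ._+_ (ℤ.*-identityʳ a) (ℤ.*-identityʳ b)))

/1-* : ∀ a b → (a ℤ.* b) / 1 ≡ (a / 1) ℚ.* (b / 1)
/1-* a b rewrite /1≡mkℚ a | /1≡mkℚ b = refl

/1-neg : ∀ a → (ℤ.- a) / 1 ≡ ℚ.- (a / 1)
/1-neg a rewrite /1≡mkℚ a | /1≡mkℚ (ℤ.- a) with a
... | + 0      = refl
... | +[1+ _ ] = refl
... | -[1+ _ ] = refl

/1-injective : ∀ {a b} → a / 1 ≡ b / 1 → a ≡ b
/1-injective {a} {b} eq rewrite /1≡mkℚ a | /1≡mkℚ b = cong ℚ.ℚ.numerator eq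

/1-mono-≤ : ∀ {a b} → a ℤ.≤ b → a / 1 ℚ.≤ b / 1
/1-mono-≤ {a} {b} a≤b rewrite /1≡mkℚ a | /1≡mkℚ b =
  *≤* (subst₂ ℤ._≤_ (sym (ℤ.*-identityʳ a)) (sym (ℤ.*-identityʳ b)) a≤b)

/1-cancel-< : ∀ {a b} → a / 1 ℚ.< b / 1 → a ℤ.< b
/1-cancel-< {a} {b} a<b rewrite /1≡mkℚ a | /1≡mkℚ b with a<b
... | *<* a<b = subst₂ ℤ._<_ (ℤ.*-identityʳ a) (ℤ.*-identityʳ b) a<b

sum-/1 : ∀ {n} (z : Fin n → ℤ) → Σℚ.sum (λ k → z k / 1) ≡ Σℤ.sum z / 1
sum-/1 {zero}  z = refl
sum-/1 {suc n} z = trans (cong (z zero / 1 ℚ.+_) (sum-/1 (z ∘ suc))) (sym (/1-+ (z zero) (Σℤ.sum (z ∘ suc))))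

sum-+ : ∀ {n} (g : Fin n → ℕ) → Σℤ.sum (λ k → + g k) ≡ + Σℕ.sum g
sum-+ {zero}  g = refl
sum-+ {suc n} g = trans (cong (ℤ._+_ (+ g zero)) (sum-+ (g ∘ suc))) (sym (ℤ.pos-+ (g zero) (Σℕ.sum (g ∘ suc))))

no-integer-strictly-between-0-1 : ∀ a → 0ℚ ℚ.< a / 1 → a / 1 ℚ.< 1ℚ → ⊥
no-integer-strictly-between-0-1 a 0<a a<1 with /1-cancel-< {+ 0} {a} 0<a | /1-cancel-< {a} {+ 1} a<1
... | ℤ.+<+ (s≤s _) | ℤ.+<+ (s≤s ())

1/[1+n]≡mkℚ : ∀ n → + 1 / suc n ≡ mkℚ (+ 1) n (Coprimality.1-coprimeTo (suc n))
1/[1+n]≡mkℚ n = ℚ.normalize-coprime (Coprimality.1-coprimeTo (suc n))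

fraction : ∀ a n → + a / suc n ≡ (+ a / 1) ℚ.* (+ 1 / suc n)
fraction a n rewrite /1≡mkℚ (+ a) | 1/[1+n]≡mkℚ n =
  ℚ./-cong (sym (ℤ.*-identityʳ (+ a))) (sym (ℕ.*-identityˡ (suc n)))

fraction-inverse : ∀ n → (+ suc n / 1) ℚ.* (+ 1 / suc n) ≡ 1ℚ
fraction-inverse n rewrite /1≡mkℚ (+ suc n) | 1/[1+n]≡mkℚ n = begin
  (+ suc n ℤ.* + 1) / (1 ℕ.* suc n)  ≡⟨ ℚ./-cong (ℤ.*-identityʳ (+ suc n)) (ℕ.*-identityˡ (suc n)) ⟩
  ℚ.fromℚᵘ (ℚᵘ.mkℚᵘ (+ suc n) n)
    ≡⟨ ℚ.fromℚᵘ-cong {ℚᵘ.mkℚᵘ (+ suc n) n} {ℚᵘ.mkℚᵘ (+ 1) 0} (ℚᵘ.*≡* (ℤ.*-comm (+ suc n) (+ 1))) ⟩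
  1ℚ                                 ∎
  where open ≡-Reasoning

fraction-clear : ∀ a n → (+ suc n / 1) ℚ.* (+ a / suc n) ≡ + a / 1
fraction-clear a n = begin
  δ ℚ.* (+ a / suc n)      ≡⟨ cong (δ ℚ.*_) (fraction a n) ⟩
  δ ℚ.* ((+ a / 1) ℚ.* D)  ≡⟨ solve 3 (λ x y z → x :* (y :* z) := y :* (x :* z)) refl δ (+ a / 1) D ⟩
  (+ a / 1) ℚ.* (δ ℚ.* D)  ≡⟨ cong ((+ a / 1) ℚ.*_) (fraction-inverse n) ⟩
  (+ a / 1) ℚ.* 1ℚ         ≡⟨ ℚ.*-identityʳ (+ a / 1) ⟩
  + a / 1                  ∎
  where
  open ≡-Reasoning
  open ℚ-Solver
  δ D : ℚ
  δ = + suc n / 1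
  D = + 1 / suc n

fromℚᵘ-mono-< : ∀ {p q} → p ℚᵘ.< q → ℚ.fromℚᵘ p ℚ.< ℚ.fromℚᵘ q
fromℚᵘ-mono-< {p} {q} p<q = ℚ.toℚᵘ-cancel-<
  (ℚᵘ.<-respʳ-≃ (ℚᵘ.≃-sym (ℚ.toℚᵘ-fromℚᵘ q)) (ℚᵘ.<-respˡ-≃ (ℚᵘ.≃-sym (ℚ.toℚᵘ-fromℚᵘ p)) p<q))

m/[1+m]<1 : ∀ m → + m / suc m ℚ.< 1ℚ
m/[1+m]<1 m = fromℚᵘ-mono-< {ℚᵘ.mkℚᵘ (+ m) m} {ℚᵘ.mkℚᵘ (+ 1) 0} (ℚᵘ.*<*
  (subst₂ ℤ._<_ (sym (ℤ.*-identityʳ (+ m))) (sym (ℤ.*-identityˡ (+ suc m))) (ℤ.+<+ (ℕ.n<1+n m))))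

[1+m]/[3+m]<m/[1+m] : ∀ m → 2 ℕ.≤ m → + suc m / suc (suc (suc m)) ℚ.< + m / suc m
[1+m]/[3+m]<m/[1+m] m@(suc (suc k)) (s≤s (s≤s z≤n)) =
  fromℚᵘ-mono-< {ℚᵘ.mkℚᵘ (+ suc m) (suc (suc m))} {ℚᵘ.mkℚᵘ (+ m) m}
    (ℚᵘ.*<* (subst₂ ℤ._<_ (ℤ.pos-* (suc m) (suc m)) (ℤ.pos-* m (suc (suc (suc m)))) (ℤ.+<+ square<)))
  where
  open ℕ-Solver
  square< : suc m ℕ.* suc m ℕ.< m ℕ.* suc (suc (suc m))
  square< = subst (suc m ℕ.* suc m ℕ.<_)
    (solve 1 (λ k → (con 3 :+ k) :* (con 3 :+ k) :+ (con 1 :+ k) := (con 2 :+ k) :* (con 5 :+ k)) refl k)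
    (ℕ.m<m+n (suc m ℕ.* suc m) (s≤s z≤n))

<⇒0<- : ∀ {p q} → p ℚ.< q → 0ℚ ℚ.< q ℚ.- p
<⇒0<- {p} {q} p<q = subst (ℚ._< q ℚ.- p) (ℚ.+-inverseʳ p) (ℚ.+-monoˡ-< (ℚ.- p) p<q)

≤⇒0≤- : ∀ {p q} → p ℚ.≤ q → 0ℚ ℚ.≤ q ℚ.- p
≤⇒0≤- {p} {q} p≤q = subst (ℚ._≤ q ℚ.- p) (ℚ.+-inverseʳ p) (ℚ.+-monoˡ-≤ (ℚ.- p) p≤q)

0<-⇒< : ∀ {p q} → 0ℚ ℚ.< q ℚ.- p → p ℚ.< q
0<-⇒< {p} {q} 0<q-p =
  subst₂ ℚ._<_ (ℚ.+-identityˡ p) (solve 2 (λ p q → (q :- p) :+ p := q) refl p q) (ℚ.+-monoˡ-< p 0<q-p)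
  where open ℚ-Solver

shrink-toward-½ : ∀ {λ′ τ} → 0ℚ ℚ.≤ λ′ → λ′ ℚ.< 1ℚ → 0ℚ ℚ.≤ τ → τ ℚ.≤ 1ℚ →
                  0ℚ ℚ.< ½ ℚ.+ λ′ ℚ.* (τ ℚ.- ½) × ½ ℚ.+ λ′ ℚ.* (τ ℚ.- ½) ℚ.< 1ℚ
shrink-toward-½ {λ′} {τ} 0≤λ λ<1 0≤τ τ≤1 =
  subst (0ℚ ℚ.<_)
    (solve 2 (λ l t → con ½ :* (con 1ℚ :- l) :+ l :* t := con ½ :+ l :* (t :- con ½)) refl λ′ τ)
    (ℚ.+-mono-<-≤ half-gap (λ-scaled 0≤τ)) ,
  0<-⇒< (subst (0ℚ ℚ.<_)
    (solve 2 (λ l t → con ½ :* (con 1ℚ :- l) :+ l :* (con 1ℚ :- t) := con 1ℚ :- (con ½ :+ l :* (t :- con ½)))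
           refl λ′ τ)
    (ℚ.+-mono-<-≤ half-gap (λ-scaled (≤⇒0≤- τ≤1))))
  where
  open ℚ-Solver
  half-gap : 0ℚ ℚ.< ½ ℚ.* (1ℚ ℚ.- λ′)
  half-gap = subst (ℚ._< ½ ℚ.* (1ℚ ℚ.- λ′)) (ℚ.*-zeroʳ ½) (ℚ.*-monoʳ-<-pos ½ (<⇒0<- λ<1))
  λ-scaled : ∀ {a} → 0ℚ ℚ.≤ a → 0ℚ ℚ.≤ λ′ ℚ.* a
  λ-scaled {a} 0≤a =
    subst (ℚ._≤ λ′ ℚ.* a) (ℚ.*-zeroʳ λ′) (ℚ.*-monoˡ-≤-nonNeg λ′ {{ℚ.nonNegative 0≤λ}} 0≤a)

∣∧small⇒≡0 : ∀ {d} z → + d ∣ z → ℤ.∣ z ∣ ℕ.< d → z ≡ + 0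
∣∧small⇒≡0 (+ zero) _   _   = refl
∣∧small⇒≡0 +[1+ _ ] d∣z z<d = contradiction (ℕ.∣⇒≤ (∣⇒∣ᵤ d∣z)) (ℕ.<⇒≱ z<d)
∣∧small⇒≡0 -[1+ _ ] d∣z z<d = contradiction (ℕ.∣⇒≤ (∣⇒∣ᵤ d∣z)) (ℕ.<⇒≱ z<d)

prime-∣-* : ∀ {d} → Prime d → ∀ a b → + d ∣ a ℤ.* b → + d ∣ a ⊎ + d ∣ b
prime-∣-* {d} d-prime a b d∣ab
  with euclidsLemma ℤ.∣ a ∣ ℤ.∣ b ∣ d-prime (subst (d ℕ.∣_) (ℤ.abs-* a b) (∣⇒∣ᵤ d∣ab))
... | inj₁ d∣a = inj₁ (∣ᵤ⇒∣ d∣a)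
... | inj₂ d∣b = inj₂ (∣ᵤ⇒∣ d∣b)

minimum : ∀ {n} (N : Fin (suc n) → ℤ) → ∃ λ i → ∀ j → N i ℤ.≤ N j
minimum {zero}  N = zero , λ { zero → ℤ.≤-refl }
minimum {suc n} N with minimum (N ∘ suc)
... | i , Ni≤ with ℤ.≤-total (N zero) (N (suc i))
...   | inj₁ N0≤Ni = zero , λ { zero → ℤ.≤-refl ; (suc j) → ℤ.≤-trans N0≤Ni (Ni≤ j) }
...   | inj₂ Ni≤N0 = suc i , λ { zero → Ni≤N0 ; (suc j) → Ni≤ j }

short-range-collision : ∀ {m} (N : Fin (suc m) → ℤ) → (∀ i j → N i ℤ.- N j ℤ.< + m) →
                        ∃ λ i → ∃ λ j → i ≢ j × N i ≡ N j
short-range-collision {m} N close = i , j , Fin.<⇒≢ i<j , ℤ.i-j≡0⇒i≡j (N i) (N j) (begin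
  N i ℤ.- N j                        ≡⟨ ℤ.+-minus-telescope (N i) (N i₀) (N j) ⟨
  (N i ℤ.- N i₀) ℤ.+ (N i₀ ℤ.- N j)  ≡⟨ cong (ℤ._+ (N i₀ ℤ.- N j)) same-gap ⟩
  (N j ℤ.- N i₀) ℤ.+ (N i₀ ℤ.- N j)  ≡⟨ ℤ.+-minus-telescope (N j) (N i₀) (N j) ⟩
  N j ℤ.- N j                        ≡⟨ ℤ.+-inverseʳ (N j) ⟩
  + 0                                ∎)
  where
  open ≡-Reasoning
  i₀ : Fin (suc m)
  i₀ = proj₁ (minimum N)
  gap : ∀ i → + ℤ.∣ N i₀ ℤ.- N i ∣ ≡ N i ℤ.- N i₀
  gap i = ℤ.∣-∣-≤ (proj₂ (minimum N) i)
  gap<m : ∀ i → ℤ.∣ N i₀ ℤ.- N i ∣ ℕ.< m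
  gap<m i = ℤ.drop‿+<+ (subst (ℤ._< + m) (sym (gap i)) (close i i₀))
  collision : ∃ λ i → ∃ λ j → i Fin.< j × Fin.fromℕ< (gap<m i) ≡ Fin.fromℕ< (gap<m j)
  collision = Fin.pigeonhole (ℕ.n<1+n m) (λ i → Fin.fromℕ< (gap<m i))
  i j : Fin (suc m)
  i = proj₁ collision
  j = proj₁ (proj₂ collision)
  i<j : i Fin.< j
  i<j = proj₁ (proj₂ (proj₂ collision))
  same-gap : N i ℤ.- N i₀ ≡ N j ℤ.- N i₀
  same-gap = trans (sym (gap i)) (trans (cong +_ same-∣gap∣) (gap j))
    where
    same-∣gap∣ : ℤ.∣ N i₀ ℤ.- N i ∣ ≡ ℤ.∣ N i₀ ℤ.- N j ∣
    same-∣gap∣ = trans (sym (Fin.toℕ-fromℕ< (gap<m i)))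
                       (trans (cong toℕ (proj₂ (proj₂ (proj₂ collision)))) (Fin.toℕ-fromℕ< (gap<m j)))

≢0⇒1≤∣∣ : ∀ {z} → z ≢ + 0 → 1 ℕ.≤ ℤ.∣ z ∣
≢0⇒1≤∣∣ {+ zero}    z≢0 = contradiction refl z≢0
≢0⇒1≤∣∣ {+[1+ _ ]}  _   = s≤s z≤n
≢0⇒1≤∣∣ { -[1+ _ ]} _   = s≤s z≤n

pos∧≢1⇒2≤∣∣ : ∀ {z} → + 0 ℤ.< z → z ≢ + 1 → 2 ℕ.≤ ℤ.∣ z ∣
pos∧≢1⇒2≤∣∣ {+[1+ zero ]}  _ z≢1 = contradiction refl z≢1
pos∧≢1⇒2≤∣∣ {+[1+ suc _ ]} _ _   = s≤s (s≤s z≤n)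
pos∧≢1⇒2≤∣∣ {+ zero}       (ℤ.+<+ ())

neg∧≢-1⇒2≤∣∣ : ∀ {z} → z ℤ.< + 0 → z ≢ -[1+ 0 ] → 2 ℕ.≤ ℤ.∣ z ∣
neg∧≢-1⇒2≤∣∣ { -[1+ zero ]}  _ z≢-1 = contradiction refl z≢-1
neg∧≢-1⇒2≤∣∣ { -[1+ suc _ ]} _ _    = s≤s (s≤s z≤n)
neg∧≢-1⇒2≤∣∣ {+ _}           (ℤ.+<+ ())

sum≡0⇒positive : ∀ {n} (c : Fin n → ℤ) → Σℤ.sum c ≡ + 0 → ∀ {r} → c r ≢ + 0 → ∃ λ p → + 0 ℤ.< c p
sum≡0⇒positive {suc n} c Σc≡0 {r} cr≢0 with Fin.any? (λ k → + 0 ℤ.<? c k)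
... | yes found = found
... | no  none  = contradiction Σc≡0 (ℤ.<⇒≢ Σc<0)
  where
  c≤0 : ∀ k → c k ℤ.≤ + 0
  c≤0 k = ℤ.≮⇒≥ (λ 0<ck → none (k , 0<ck))
  Σc<0 : Σℤ.sum c ℤ.< + 0
  Σc<0 = ℤ.≤-<-trans (ℤ.≤-reflexive (Σℤ.sum-remove c))
           (ℤ.+-mono-<-≤ (ℤ.≤∧≢⇒< (c≤0 r) cr≢0) (sum-≤0 (removeAt c r) (c≤0 ∘ punchIn r)))

sum≡0⇒negative : ∀ {n} (c : Fin n → ℤ) → Σℤ.sum c ≡ + 0 → ∀ {r} → c r ≢ + 0 → ∃ λ q → c q ℤ.< + 0
sum≡0⇒negative c Σc≡0 cr≢0 =
  map₂ ℤ.neg-cancel-<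
    (sum≡0⇒positive (λ k → ℤ.- c k) (trans (sum-neg c) (cong ℤ.-_ Σc≡0)) (cr≢0 ∘ ℤ.neg-injective))

-- The configuration

module _ {m : ℕ} where

  ud v : Fin (suc (suc m))
  ud = inject₁ (fromℕ m)
  v  = fromℕ (suc m)

  toℕ-ud : toℕ ud ≡ m
  toℕ-ud = trans (Fin.toℕ-inject₁ (fromℕ m)) (Fin.toℕ-fromℕ m)

  toℕ-v : toℕ v ≡ suc m
  toℕ-v = Fin.toℕ-fromℕ (suc m)

  data GeneratorKind (k : Fin (suc (suc m))) : Set where
    axis  : toℕ k ℕ.< m → GeneratorKind k
    is-ud : k ≡ ud → GeneratorKind k
    is-v  : k ≡ v → GeneratorKind k

  generatorKind : ∀ k → GeneratorKind k
  generatorKind k with toℕ k <? m | toℕ k ≟ m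
  ... | yes k<m | _       = axis k<m
  ... | no  _   | yes k≡m = is-ud (Fin.toℕ-injective (trans k≡m (sym toℕ-ud)))
  ... | no  k≮m | no  k≢m = is-v (Fin.toℕ-injective (trans k≡m+1 (sym toℕ-v)))
    where
    k≡m+1 : toℕ k ≡ suc m
    k≡m+1 = ℕ.≤-antisym (ℕ.≤-pred (Fin.toℕ<n k)) (ℕ.≤∧≢⇒< (ℕ.≮⇒≥ k≮m) (k≢m ∘ sym))

  coordinateKind : ∀ (j : Fin (suc m)) → toℕ j ℕ.< m ⊎ j ≡ fromℕ m
  coordinateKind j with toℕ j <? m
  ... | yes j<m = inj₁ j<m
  ... | no  j≮m = inj₂ (Fin.toℕ-injective (trans j≡m (sym (Fin.toℕ-fromℕ m))))
    where
    j≡m : toℕ j ≡ m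
    j≡m = ℕ.≤-antisym (ℕ.≤-pred (Fin.toℕ<n j)) (ℕ.≮⇒≥ j≮m)

  module _ {k : Fin (suc (suc m))} {j : Fin (suc m)} where

    gens-axis-≡ : toℕ k ℕ.< m → toℕ j ≡ toℕ k → gens (suc m) k j ≡ 1ℚ
    gens-axis-≡ k<m j≡k with toℕ k <? m
    ... | no k≮m = contradiction k<m k≮m
    ... | yes _ with toℕ j ≟ toℕ k
    ...   | yes _   = refl
    ...   | no  j≢k = contradiction j≡k j≢k

    gens-axis-≢ : toℕ k ℕ.< m → toℕ j ≢ toℕ k → gens (suc m) k j ≡ 0ℚ
    gens-axis-≢ k<m j≢k with toℕ k <? m
    ... | no k≮m = contradiction k<m k≮m
    ... | yes _ with toℕ j ≟ toℕ k
    ...   | yes j≡k = contradiction j≡k j≢k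
    ...   | no  _   = refl

    gens-ud-axis : toℕ k ≡ m → toℕ j ℕ.< m → gens (suc m) k j ≡ ℚ.- 1ℚ
    gens-ud-axis k≡m j<m with toℕ k <? m
    ... | yes k<m = contradiction k<m (ℕ.<-irrefl k≡m)
    ... | no  _ with toℕ k ≟ m
    ...   | no k≢m = contradiction k≡m k≢m
    ...   | yes _ with toℕ j <? m
    ...     | yes _   = refl
    ...     | no  j≮m = contradiction j<m j≮m

    gens-ud-last : toℕ k ≡ m → toℕ j ≡ m → gens (suc m) k j ≡ 0ℚ
    gens-ud-last k≡m j≡m with toℕ k <? m
    ... | yes k<m = contradiction k<m (ℕ.<-irrefl k≡m)
    ... | no  _ with toℕ k ≟ m
    ...   | no k≢m = contradiction k≡m k≢m
    ...   | yes _ with toℕ j <? m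
    ...     | yes j<m = contradiction j<m (ℕ.<-irrefl j≡m)
    ...     | no  _   = refl

    gens-v-axis : toℕ k ≡ suc m → toℕ j ℕ.< m → gens (suc m) k j ≡ 0ℚ
    gens-v-axis k≡m+1 j<m with toℕ k <? m
    ... | yes k<m = contradiction k<m (ℕ.<-asym (subst (m ℕ.<_) (sym k≡m+1) (ℕ.n<1+n m)))
    ... | no  _ with toℕ k ≟ m
    ...   | yes k≡m = contradiction (trans (sym k≡m+1) k≡m) ℕ.1+n≢n
    ...   | no  _ with toℕ j ≟ m
    ...     | yes j≡m = contradiction j<m (ℕ.<-irrefl j≡m)
    ...     | no  _   = refl

    gens-v-last : toℕ k ≡ suc m → toℕ j ≡ m → gens (suc m) k j ≡ 1ℚ
    gens-v-last k≡m+1 j≡m with toℕ k <? m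
    ... | yes k<m = contradiction k<m (ℕ.<-asym (subst (m ℕ.<_) (sym k≡m+1) (ℕ.n<1+n m)))
    ... | no  _ with toℕ k ≟ m
    ...   | yes k≡m = contradiction (trans (sym k≡m+1) k≡m) ℕ.1+n≢n
    ...   | no  _ with toℕ j ≟ m
    ...     | yes _   = refl
    ...     | no  j≢m = contradiction j≡m j≢m

  private
    toℕ≡⇒≡inject₁ : ∀ {k : Fin (suc (suc m))} (j : Fin (suc m)) → toℕ j ≡ toℕ k → k ≡ inject₁ j
    toℕ≡⇒≡inject₁ j j≡k = Fin.toℕ-injective (trans (sym j≡k) (sym (Fin.toℕ-inject₁ j)))

  combination-axis : ∀ (t : Fin (suc (suc m)) → ℚ) j → toℕ j ℕ.< m →
                     combination t (gens (suc m)) j ≡ t (inject₁ j) ℚ.- t ud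
  combination-axis t j j<m = begin
    combination t (gens (suc m)) j                ≡⟨ sumFin≡sum (λ k → t k ℚ.* gens (suc m) k j) ⟩
    Σℚ.sum (λ k → t k ℚ.* gens (suc m) k j)       ≡⟨ Σℚ.sum-δ₂ _ j↑≢ud others ⟩
    t (inject₁ j) ℚ.* gens (suc m) (inject₁ j) j ℚ.+ t ud ℚ.* gens (suc m) ud j
      ≡⟨ cong₂ (λ a b → t (inject₁ j) ℚ.* a ℚ.+ t ud ℚ.* b)
               (gens-axis-≡ (subst (ℕ._< m) (sym toℕ-j↑) j<m) (sym toℕ-j↑)) (gens-ud-axis toℕ-ud j<m) ⟩
    t (inject₁ j) ℚ.* 1ℚ ℚ.+ t ud ℚ.* ℚ.- 1ℚ
      ≡⟨ solve 2 (λ a b → a :* con 1ℚ :+ b :* con (ℚ.- 1ℚ) := a :- b) refl (t (inject₁ j)) (t ud) ⟩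
    t (inject₁ j) ℚ.- t ud
      ∎
    where
    open ≡-Reasoning
    open ℚ-Solver
    toℕ-j↑ : toℕ (inject₁ j) ≡ toℕ j
    toℕ-j↑ = Fin.toℕ-inject₁ j
    j↑≢ud : inject₁ j ≢ ud
    j↑≢ud eq = ℕ.<-irrefl (trans (sym toℕ-j↑) (trans (cong toℕ eq) toℕ-ud)) j<m
    others : ∀ k → k ≢ inject₁ j → k ≢ ud → t k ℚ.* gens (suc m) k j ≡ 0ℚ
    others k k≢j↑ k≢ud with generatorKind k
    ... | axis k<m   = trans (cong (t k ℚ.*_) (gens-axis-≢ k<m (k≢j↑ ∘ toℕ≡⇒≡inject₁ j)))
                             (ℚ.*-zeroʳ (t k))
    ... | is-ud k≡ud = contradiction k≡ud k≢ud
    ... | is-v refl  = trans (cong (t v ℚ.*_) (gens-v-axis toℕ-v j<m)) (ℚ.*-zeroʳ (t v))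

  gens-last≡0 : ∀ k → k ≢ v → gens (suc m) k (fromℕ m) ≡ 0ℚ
  gens-last≡0 k k≢v with generatorKind k
  ... | axis k<m   = gens-axis-≢ k<m (λ m≡k → ℕ.<-irrefl (trans (sym m≡k) (Fin.toℕ-fromℕ m)) k<m)
  ... | is-ud refl = gens-ud-last toℕ-ud (Fin.toℕ-fromℕ m)
  ... | is-v k≡v   = contradiction k≡v k≢v

  combination-last : ∀ (t : Fin (suc (suc m)) → ℚ) → combination t (gens (suc m)) (fromℕ m) ≡ t v
  combination-last t = begin
    combination t (gens (suc m)) (fromℕ m)           ≡⟨ sumFin≡sum (λ k → t k ℚ.* gens (suc m) k (fromℕ m)) ⟩
    Σℚ.sum (λ k → t k ℚ.* gens (suc m) k (fromℕ m))  ≡⟨ Σℚ.sum-δ _ v others ⟩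
    t v ℚ.* gens (suc m) v (fromℕ m)                 ≡⟨ cong (t v ℚ.*_) (gens-v-last toℕ-v (Fin.toℕ-fromℕ m)) ⟩
    t v ℚ.* 1ℚ                                       ≡⟨ ℚ.*-identityʳ (t v) ⟩
    t v                                              ∎
    where
    open ≡-Reasoning
    others : ∀ k → k ≢ v → t k ℚ.* gens (suc m) k (fromℕ m) ≡ 0ℚ
    others k k≢v = trans (cong (t k ℚ.*_) (gens-last≡0 k k≢v)) (ℚ.*-zeroʳ (t k))

  dot-gens-axis : ∀ (g : Vecℚ (suc m)) j → toℕ j ℕ.< m → dot g (gens (suc m) (inject₁ j)) ≡ g j
  dot-gens-axis g j j<m = begin
    dot g (gens (suc m) (inject₁ j))                   ≡⟨ dot≡sum g (gens (suc m) (inject₁ j)) ⟩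
    Σℚ.sum (λ i → g i ℚ.* gens (suc m) (inject₁ j) i)  ≡⟨ Σℚ.sum-δ _ j others ⟩
    g j ℚ.* gens (suc m) (inject₁ j) j                 ≡⟨ cong (g j ℚ.*_) (gens-axis-≡ j↑<m (sym (Fin.toℕ-inject₁ j))) ⟩
    g j ℚ.* 1ℚ                                         ≡⟨ ℚ.*-identityʳ (g j) ⟩
    g j                                                ∎
    where
    open ≡-Reasoning
    j↑<m : toℕ (inject₁ j) ℕ.< m
    j↑<m = subst (ℕ._< m) (sym (Fin.toℕ-inject₁ j)) j<m
    others : ∀ i → i ≢ j → g i ℚ.* gens (suc m) (inject₁ j) i ≡ 0ℚ
    others i i≢j = trans (cong (g i ℚ.*_) (gens-axis-≢ j↑<m
      (λ i≡j → i≢j (Fin.toℕ-injective (trans i≡j (Fin.toℕ-inject₁ j)))))) (ℚ.*-zeroʳ (g i))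

  dot-gens-v : ∀ (g : Vecℚ (suc m)) → dot g (gens (suc m) v) ≡ g (fromℕ m)
  dot-gens-v g = begin
    dot g (gens (suc m) v)                    ≡⟨ dot≡sum g (gens (suc m) v) ⟩
    Σℚ.sum (λ i → g i ℚ.* gens (suc m) v i)   ≡⟨ Σℚ.sum-δ _ (fromℕ m) others ⟩
    g (fromℕ m) ℚ.* gens (suc m) v (fromℕ m)
      ≡⟨ cong (g (fromℕ m) ℚ.*_) (gens-v-last toℕ-v (Fin.toℕ-fromℕ m)) ⟩
    g (fromℕ m) ℚ.* 1ℚ                        ≡⟨ ℚ.*-identityʳ (g (fromℕ m)) ⟩
    g (fromℕ m)                               ∎
    where
    open ≡-Reasoning
    others : ∀ i → i ≢ fromℕ m → g i ℚ.* gens (suc m) v i ≡ 0ℚ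
    others i i≢last with coordinateKind i
    ... | inj₁ i<m    = trans (cong (g i ℚ.*_) (gens-v-axis toℕ-v i<m)) (ℚ.*-zeroʳ (g i))
    ... | inj₂ i≡last = contradiction i≡last i≢last

  combination-1≡v : ∀ j → combination (λ _ → 1ℚ) (gens (suc m)) j ≡ gens (suc m) v j
  combination-1≡v j with coordinateKind j
  ... | inj₁ j<m  = trans (combination-axis (λ _ → 1ℚ) j j<m) (sym (gens-v-axis toℕ-v j<m))
  ... | inj₂ refl = trans (combination-last (λ _ → 1ℚ)) (sym (gens-v-last toℕ-v (Fin.toℕ-fromℕ m)))

  sum-init-dot-gens≡0 : ∀ (g : Vecℚ (suc m)) → Σℚ.sum (init (λ k → dot g (gens (suc m) k))) ≡ 0ℚ
  sum-init-dot-gens≡0 g = identityˡ-unique _ _ (begin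
    Σℚ.sum (init c) ℚ.+ c v                       ≡⟨ Σℚ.sum-init-last c ⟨
    Σℚ.sum c                                      ≡⟨ Σℚ.sum-cong-≗ (λ k → sym (ℚ.*-identityˡ (c k))) ⟩
    Σℚ.sum (λ k → 1ℚ ℚ.* c k)                     ≡⟨ sumFin≡sum (λ k → 1ℚ ℚ.* c k) ⟨
    sumFin (λ k → 1ℚ ℚ.* c k)                     ≡⟨ dot-combination g (λ _ → 1ℚ) (gens (suc m)) ⟨
    dot g (combination (λ _ → 1ℚ) (gens (suc m))) ≡⟨ dot-congʳ g combination-1≡v ⟩
    c v                                           ∎)
    where
    open ≡-Reasoning
    c : Fin (suc (suc m)) → ℚ
    c k = dot g (gens (suc m) k)

  dot-gens≡0⇒≡0 : ∀ (g : Vecℚ (suc m)) → (∀ k → dot g (gens (suc m) k) ≡ 0ℚ) → ∀ j → g j ≡ 0ℚ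
  dot-gens≡0⇒≡0 g g·u≡0 j with coordinateKind j
  ... | inj₁ j<m  = trans (sym (dot-gens-axis g j j<m)) (g·u≡0 (inject₁ j))
  ... | inj₂ refl = trans (sym (dot-gens-v g)) (g·u≡0 v)

  center-gens : ∀ j → center (gens (suc m)) j ≡ ½ ℚ.* gens (suc m) v j
  center-gens j = cong (½ ℚ.*_) (begin
    sumFin (λ k → gens (suc m) k j)          ≡⟨ sumFin≡sum (λ k → gens (suc m) k j) ⟩
    Σℚ.sum (λ k → gens (suc m) k j)          ≡⟨ Σℚ.sum-cong-≗ (λ k → sym (ℚ.*-identityˡ (gens (suc m) k j))) ⟩
    Σℚ.sum (λ k → 1ℚ ℚ.* gens (suc m) k j)   ≡⟨ sumFin≡sum (λ k → 1ℚ ℚ.* gens (suc m) k j) ⟨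
    combination (λ _ → 1ℚ) (gens (suc m)) j  ≡⟨ combination-1≡v j ⟩
    gens (suc m) v j                         ∎)
    where open ≡-Reasoning

-- d·w = Σₖ weight m (toℕ k) · uₖ, and on 0, …, m the weights are 1, …, m, 0: distinct mod d.
weight : ℕ → ℕ → ℕ
weight m a with a <? m | a ≟ m
... | yes _ | _     = suc a
... | no  _ | yes _ = 0
... | no  _ | no  _ = 1

module _ {m : ℕ} where

  weight-< : ∀ {a} → a ℕ.< m → weight m a ≡ suc a
  weight-< {a} a<m with a <? m
  ... | yes _   = refl
  ... | no  a≮m = contradiction a<m a≮m

  weight-m : weight m m ≡ 0
  weight-m with m <? m | m ≟ m
  ... | yes m<m | _       = contradiction m<m (ℕ.<-irrefl refl)
  ... | no  _   | yes _   = refl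
  ... | no  _   | no  m≢m = contradiction refl m≢m

  weight-1+m : weight m (suc m) ≡ 1
  weight-1+m with suc m <? m | suc m ≟ m
  ... | yes m+1<m | _         = contradiction m+1<m (ℕ.<-asym (ℕ.n<1+n m))
  ... | no  _     | yes m+1≡m = contradiction m+1≡m ℕ.1+n≢n
  ... | no  _     | no  _     = refl

  weight-≤ : ∀ {a} → a ℕ.≤ m → weight m a ℕ.≤ m
  weight-≤ a≤m with ℕ.m≤n⇒m<n∨m≡n a≤m
  ... | inj₁ a<m  = ℕ.≤-trans (ℕ.≤-reflexive (weight-< a<m)) a<m
  ... | inj₂ refl = ℕ.≤-trans (ℕ.≤-reflexive weight-m) z≤n

  weight-injective : ∀ {a b} → a ℕ.≤ m → b ℕ.≤ m → weight m a ≡ weight m b → a ≡ b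
  weight-injective a≤m b≤m eq with ℕ.m≤n⇒m<n∨m≡n a≤m | ℕ.m≤n⇒m<n∨m≡n b≤m
  ... | inj₁ a<m  | inj₁ b<m  = ℕ.suc-injective (trans (sym (weight-< a<m)) (trans eq (weight-< b<m)))
  ... | inj₁ a<m  | inj₂ refl = contradiction (trans (sym (weight-< a<m)) (trans eq weight-m)) ℕ.1+n≢0
  ... | inj₂ refl | inj₁ b<m  = contradiction (trans (sym (weight-< b<m)) (trans (sym eq) weight-m)) ℕ.1+n≢0
  ... | inj₂ refl | inj₂ refl = refl

  weight-separated : ∀ {a b} → a ℕ.≤ m → b ℕ.≤ m → + suc m ∣ + weight m a ℤ.- + weight m b → a ≡ b
  weight-separated {a} {b} a≤m b≤m d∣ = weight-injective a≤m b≤m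
    (ℤ.+-injective (ℤ.i-j≡0⇒i≡j _ _ (∣∧small⇒≡0 _ d∣ small)))
    where
    small : ℤ.∣ + weight m a ℤ.- + weight m b ∣ ℕ.< suc m
    small = s≤s (begin
      ℤ.∣ + weight m a ℤ.- + weight m b ∣  ≡⟨ cong ℤ.∣_∣ (ℤ.[+m]-[+n]≡m⊖n (weight m a) (weight m b)) ⟩
      ℤ.∣ weight m a ℤ.⊖ weight m b ∣      ≤⟨ ℤ.∣m⊝n∣≤m⊔n (weight m a) (weight m b) ⟩
      weight m a ℕ.⊔ weight m b            ≤⟨ ℕ.⊔-lub (weight-≤ a≤m) (weight-≤ b≤m) ⟩
      m                                    ∎)
      where open ℕ.≤-Reasoning

  wvec-axis : ∀ j → toℕ j ℕ.< m → wvec (suc m) j ≡ + suc (toℕ j) / suc m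
  wvec-axis j j<m with toℕ j <? m
  ... | yes _   = refl
  ... | no  j≮m = contradiction j<m j≮m

  wvec-last : wvec (suc m) (fromℕ m) ≡ + 1 / suc m
  wvec-last with toℕ (fromℕ m) <? m
  ... | yes m<m = contradiction (subst (ℕ._< m) (Fin.toℕ-fromℕ m) m<m) (ℕ.<-irrefl refl)
  ... | no  _   = refl

  combination-weight : ∀ j → combination (λ k → + weight m (toℕ k) / 1) (gens (suc m)) j ≡
                             (+ suc m / 1) ℚ.* wvec (suc m) j
  combination-weight j with coordinateKind j
  ... | inj₁ j<m = begin
    combination ω (gens (suc m)) j            ≡⟨ combination-axis ω j j<m ⟩
    ω (inject₁ j) ℚ.- ω ud
      ≡⟨ cong₂ (λ a b → + weight m a / 1 ℚ.- + weight m b / 1) (Fin.toℕ-inject₁ j) toℕ-ud ⟩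
    + weight m (toℕ j) / 1 ℚ.- + weight m m / 1
      ≡⟨ cong₂ (λ a b → + a / 1 ℚ.- + b / 1) (weight-< j<m) weight-m ⟩
    + suc (toℕ j) / 1 ℚ.- 0ℚ                 ≡⟨ ℚ.+-identityʳ _ ⟩
    + suc (toℕ j) / 1                         ≡⟨ fraction-clear (suc (toℕ j)) m ⟨
    (+ suc m / 1) ℚ.* (+ suc (toℕ j) / suc m) ≡⟨ cong ((+ suc m / 1) ℚ.*_) (wvec-axis j j<m) ⟨
    (+ suc m / 1) ℚ.* wvec (suc m) j          ∎
    where
    open ≡-Reasoning
    ω : Fin (suc (suc m)) → ℚ
    ω k = + weight m (toℕ k) / 1
  ... | inj₂ refl = begin
    combination ω (gens (suc m)) (fromℕ m)    ≡⟨ combination-last ω ⟩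
    + weight m (toℕ v) / 1                    ≡⟨ cong (λ a → + weight m a / 1) toℕ-v ⟩
    + weight m (suc m) / 1                    ≡⟨ cong (λ a → + a / 1) weight-1+m ⟩
    + 1 / 1                                   ≡⟨ fraction-clear 1 m ⟨
    (+ suc m / 1) ℚ.* (+ 1 / suc m)           ≡⟨ cong ((+ suc m / 1) ℚ.*_) wvec-last ⟨
    (+ suc m / 1) ℚ.* wvec (suc m) (fromℕ m)  ∎
    where
    open ≡-Reasoning
    ω : Fin (suc (suc m)) → ℚ
    ω k = + weight m (toℕ k) / 1

-- Coloops

module _ {m : ℕ} where

  dot-init-gens≡0 : ∀ (g : Vecℚ (suc m)) k → (∀ i → i ≢ inject₁ k → dot g (gens (suc m) i) ≡ 0ℚ) →
                    dot g (gens (suc m) (inject₁ k)) ≡ 0ℚ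
  dot-init-gens≡0 g k others =
    trans (sym (Σℚ.sum-δ (init c) k (λ i i≢k → others (inject₁ i) (i≢k ∘ Fin.inject₁-injective))))
          (sum-init-dot-gens≡0 g)
    where
    c : Fin (suc (suc m)) → ℚ
    c i = dot g (gens (suc m) i)

  ¬coloop-init : ∀ k → ¬ IsColoop (gens (suc m)) (inject₁ k)
  ¬coloop-init k (g , (j , gj≢0) , others) = gj≢0 (dot-gens≡0⇒≡0 g all≡0 j)
    where
    all≡0 : ∀ i → dot g (gens (suc m) i) ≡ 0ℚ
    all≡0 i with i Fin.≟ inject₁ k
    ... | yes refl = dot-init-gens≡0 g k others
    ... | no  i≢k  = others i i≢k

  coloop-v : IsColoop (gens (suc m)) v
  coloop-v = gens (suc m) v , (fromℕ m , 1≢0) , others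
    where
    1≢0 : gens (suc m) v (fromℕ m) ≢ 0ℚ
    1≢0 eq with trans (sym (gens-v-last toℕ-v (Fin.toℕ-fromℕ m))) eq
    ... | ()
    others : ∀ i → i ≢ v → dot (gens (suc m) v) (gens (suc m) i) ≡ 0ℚ
    others i i≢v = trans (dot-comm (gens (suc m) v) (gens (suc m) i))
                         (trans (dot-gens-v (gens (suc m) i)) (gens-last≡0 i i≢v))

  coloop⇔v : ∀ k → IsColoop (gens (suc m)) k ⇔ toℕ k ≡ suc m
  coloop⇔v k = mk⇔ coloop⇒v v⇒coloop
    where
    coloop⇒v : IsColoop (gens (suc m)) k → toℕ k ≡ suc m
    coloop⇒v coloop with toℕ k ≟ suc m
    ... | yes k≡v = k≡v
    ... | no  k≢v = contradiction (subst (IsColoop (gens (suc m))) (sym (Fin.inject₁-lower₁ k (k≢v ∘ sym))) coloop)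
                                  (¬coloop-init _)
    v⇒coloop : toℕ k ≡ suc m → IsColoop (gens (suc m)) k
    v⇒coloop k≡v = subst (IsColoop (gens (suc m))) (Fin.toℕ-injective (trans toℕ-v (sym k≡v))) coloop-v

-- Lattice width

ℓ¹ : ∀ {n} → (Fin n → ℤ) → ℕ
ℓ¹ c = Σℕ.sum (λ k → ℤ.∣ c k ∣)

Separated : ℕ → ∀ {n} → (Fin n → ℤ) → Set
Separated d ω = ∀ p q → + d ∣ ω p ℤ.- ω q → p ≡ q

weighted-sum-dipole : ∀ {n} (ω c : Fin (suc (suc n)) → ℤ) {p q} (p≢q : p ≢ q) →
                      (∀ k → without₂ c p≢q k ≡ + 0) → c p ≡ + 1 → c q ≡ -[1+ 0 ] →
                      Σℤ.sum (λ k → ω k ℤ.* c k) ≡ ω p ℤ.- ω q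
weighted-sum-dipole {n} ω c {p} {q} p≢q rest≡0 cp≡1 cq≡-1 = begin
  Σℤ.sum ωc
    ≡⟨ Σℤ.sum-remove₂ ωc p≢q ⟩
  ω p ℤ.* c p ℤ.+ (ω q ℤ.* c q ℤ.+ Σℤ.sum (without₂ ωc p≢q))
    ≡⟨ cong₂ (λ x y → ω p ℤ.* x ℤ.+ (ω q ℤ.* y ℤ.+ Σℤ.sum (without₂ ωc p≢q))) cp≡1 cq≡-1 ⟩
  ω p ℤ.* + 1 ℤ.+ (ω q ℤ.* -[1+ 0 ] ℤ.+ Σℤ.sum (without₂ ωc p≢q))
    ≡⟨ cong (λ x → ω p ℤ.* + 1 ℤ.+ (ω q ℤ.* -[1+ 0 ] ℤ.+ x)) Σrest≡0 ⟩
  ω p ℤ.* + 1 ℤ.+ (ω q ℤ.* -[1+ 0 ] ℤ.+ + 0)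
    ≡⟨ solve 2 (λ x y → x :* con (+ 1) :+ (y :* con -[1+ 0 ] :+ con (+ 0)) := x :- y) refl (ω p) (ω q) ⟩
  ω p ℤ.- ω q
    ∎
  where
  open ≡-Reasoning
  open ℤ-Solver
  ωc : Fin (suc (suc n)) → ℤ
  ωc k = ω k ℤ.* c k
  Σrest≡0 : Σℤ.sum (without₂ ωc p≢q) ≡ + 0
  Σrest≡0 = Σℤ.sum-zero _ (λ k → trans (cong (ℤ._*_ (ω _)) (rest≡0 k)) (ℤ.*-zeroʳ (ω _)))

-- Already |cₚ|, |c_q| ≥ 1; the third unit comes from c₀, from the remaining entries, or from
-- |cₚ| ≥ 2 or |c_q| ≥ 2, unless c = eₚ − e_q and c₀ = 0, which separation rules out.
opposite-signs-ℓ¹≥3 : ∀ {d n} {ω : Fin n → ℤ} → Separated d ω → (c : Fin n → ℤ) (c₀ : ℤ) →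
                      + d ∣ Σℤ.sum (λ k → ω k ℤ.* c k) ℤ.+ c₀ →
                      ∀ {p q} → p ≢ q → + 0 ℤ.< c p → c q ℤ.< + 0 →
                      3 ℕ.≤ ℓ¹ c ℕ.+ ℤ.∣ c₀ ∣
opposite-signs-ℓ¹≥3 {n = suc zero} _ _ _ _ {zero} {zero} p≢q _ _ = contradiction refl p≢q
opposite-signs-ℓ¹≥3 {d} {suc (suc n)} {ω} separated c c₀ d∣ {p} {q} p≢q 0<cp cq<0 = cases
  where
  R : ℕ
  R = Σℕ.sum (without₂ (λ k → ℤ.∣ c k ∣) p≢q)

  1≤∣cp∣ : 1 ℕ.≤ ℤ.∣ c p ∣
  1≤∣cp∣ = ≢0⇒1≤∣∣ (ℤ.<⇒≢ 0<cp ∘ sym)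

  1≤∣cq∣ : 1 ℕ.≤ ℤ.∣ c q ∣
  1≤∣cq∣ = ≢0⇒1≤∣∣ (ℤ.<⇒≢ cq<0)

  bound : ∀ {a b r e} → a ℕ.≤ ℤ.∣ c p ∣ → b ℕ.≤ ℤ.∣ c q ∣ → r ℕ.≤ R → e ℕ.≤ ℤ.∣ c₀ ∣ →
          a ℕ.+ (b ℕ.+ r) ℕ.+ e ℕ.≤ ℓ¹ c ℕ.+ ℤ.∣ c₀ ∣
  bound {a} {b} {r} {e} a≤ b≤ r≤ e≤ =
    subst (λ x → a ℕ.+ (b ℕ.+ r) ℕ.+ e ℕ.≤ x ℕ.+ ℤ.∣ c₀ ∣) (sym (Σℕ.sum-remove₂ (λ k → ℤ.∣ c k ∣) p≢q))
          (ℕ.+-mono-≤ (ℕ.+-mono-≤ a≤ (ℕ.+-mono-≤ b≤ r≤)) e≤)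

  cases : 3 ℕ.≤ ℓ¹ c ℕ.+ ℤ.∣ c₀ ∣
  cases with c₀ ℤ.≟ + 0 | R ℕ.≟ 0 | c p ℤ.≟ + 1 | c q ℤ.≟ -[1+ 0 ]
  ... | no c₀≢0  | _       | _        | _         = bound 1≤∣cp∣ 1≤∣cq∣ z≤n (≢0⇒1≤∣∣ c₀≢0)
  ... | yes _    | no R≢0  | _        | _         = bound 1≤∣cp∣ 1≤∣cq∣ (ℕ.n≢0⇒n>0 R≢0) z≤n
  ... | yes _    | yes _   | no cp≢1  | _         = bound (pos∧≢1⇒2≤∣∣ 0<cp cp≢1) 1≤∣cq∣ z≤n z≤n
  ... | yes _    | yes _   | yes _    | no cq≢-1  = bound 1≤∣cp∣ (neg∧≢-1⇒2≤∣∣ cq<0 cq≢-1) z≤n z≤n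
  ... | yes c₀≡0 | yes R≡0 | yes cp≡1 | yes cq≡-1 =
    contradiction (separated p q (subst (+ d ∣_) Σωc+c₀≡ωp-ωq d∣)) p≢q
    where
    rest≡0 : ∀ k → without₂ c p≢q k ≡ + 0
    rest≡0 k = ℤ.∣i∣≡0⇒i≡0 (sum≡0⇒≡0 (without₂ (λ k → ℤ.∣ c k ∣) p≢q) R≡0 k)
    Σωc+c₀≡ωp-ωq : Σℤ.sum (λ k → ω k ℤ.* c k) ℤ.+ c₀ ≡ ω p ℤ.- ω q
    Σωc+c₀≡ωp-ωq =
      trans (cong₂ ℤ._+_ (weighted-sum-dipole ω c p≢q rest≡0 cp≡1 cq≡-1) c₀≡0) (ℤ.+-identityʳ _)

balanced-ℓ¹≥3 : ∀ {d n} {ω : Fin n → ℤ} → 3 ℕ.≤ d → Separated d ω → (c : Fin n → ℤ) (c₀ : ℤ) →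
                Σℤ.sum c ≡ + 0 → + d ∣ Σℤ.sum (λ k → ω k ℤ.* c k) ℤ.+ c₀ →
                ¬ ((∀ k → c k ≡ + 0) × c₀ ≡ + 0) → 3 ℕ.≤ ℓ¹ c ℕ.+ ℤ.∣ c₀ ∣
balanced-ℓ¹≥3 {d} {n} {ω} 3≤d separated c c₀ Σc≡0 d∣ nonzero with Fin.all? (λ k → c k ℤ.≟ + 0)
... | no ¬c≡0 = opposite-signs-ℓ¹≥3 {ω = ω} separated c c₀ d∣ p≢q (proj₂ positive) (proj₂ negative)
  where
  nonzero-entry : ∃ λ r → c r ≢ + 0
  nonzero-entry = Fin.¬∀⟶∃¬ n _ (λ k → c k ℤ.≟ + 0) ¬c≡0
  positive : ∃ λ p → + 0 ℤ.< c p
  positive = sum≡0⇒positive c Σc≡0 (proj₂ nonzero-entry)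
  negative : ∃ λ q → c q ℤ.< + 0
  negative = sum≡0⇒negative c Σc≡0 (proj₂ nonzero-entry)
  p≢q : proj₁ positive ≢ proj₁ negative
  p≢q p≡q = ℤ.<-asym (proj₂ positive) (subst (λ k → c k ℤ.< + 0) (sym p≡q) (proj₂ negative))
... | yes c≡0 = ℕ.≤-trans 3≤d (ℕ.≤-trans d≤∣c₀∣ (ℕ.m≤n+m ℤ.∣ c₀ ∣ (ℓ¹ c)))
  where
  c₀≢0 : c₀ ≢ + 0
  c₀≢0 c₀≡0 = nonzero (c≡0 , c₀≡0)
  Σωc≡0 : Σℤ.sum (λ k → ω k ℤ.* c k) ≡ + 0
  Σωc≡0 = Σℤ.sum-zero _ (λ k → trans (cong (ℤ._*_ (ω k)) (c≡0 k)) (ℤ.*-zeroʳ (ω k)))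
  d∣c₀ : + d ∣ c₀
  d∣c₀ = subst (+ d ∣_) (trans (cong (ℤ._+ c₀) Σωc≡0) (ℤ.+-identityˡ c₀)) d∣
  d≤∣c₀∣ : d ℕ.≤ ℤ.∣ c₀ ∣
  d≤∣c₀∣ = ℕ.∣⇒≤ {{ℕ.≢-nonZero (c₀≢0 ∘ ℤ.∣i∣≡0⇒i≡0)}} (∣⇒∣ᵤ d∣c₀)

coordinate-weights-separated : ∀ m → Separated (suc m) (λ (j : Fin (suc m)) → + weight m (toℕ j))
coordinate-weights-separated m p q d∣ =
  Fin.toℕ-injective (weight-separated (ℕ.≤-pred (Fin.toℕ<n p)) (ℕ.≤-pred (Fin.toℕ<n q)) d∣)

ℤᵈ⊆Λ : ∀ {d} .{{_ : NonZero d}} {x : Vecℚ d} (z : Fin d → ℤ) → (∀ j → x j ≡ z j / 1) → Λ d x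
ℤᵈ⊆Λ {d} z x≡z = z , + 0 , λ j → trans (x≡z j)
  (sym (trans (cong (z j / 1 ℚ.+_) (ℚ.*-zeroˡ (wvec d j))) (ℚ.+-identityʳ (z j / 1))))

w∈Λ : ∀ {d} .{{_ : NonZero d}} → Λ d (wvec d)
w∈Λ {d} = (λ _ → + 0) , + 1 , λ j → sym (trans (ℚ.+-identityˡ _) (ℚ.*-identityˡ (wvec d j)))

gens-integral : ∀ d k j → ∃ λ z → gens d k j ≡ z / 1
gens-integral d k j with toℕ k <? d ∸ 1
... | yes _ with toℕ j ≟ toℕ k
...   | yes _ = + 1 , refl
...   | no  _ = + 0 , refl
gens-integral d k j | no _ with toℕ k ≟ d ∸ 1
...   | yes _ with toℕ j <? d ∸ 1
...     | yes _ = -[1+ 0 ] , refl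
...     | no  _ = + 0 , refl
gens-integral d k j | no _ | no _ with toℕ j ≟ d ∸ 1
...     | yes _ = + 1 , refl
...     | no  _ = + 0 , refl

gens∈Λ : ∀ d .{{_ : NonZero d}} k → Λ d (gens d k)
gens∈Λ d k = ℤᵈ⊆Λ (λ j → proj₁ (gens-integral d k j)) (λ j → proj₂ (gens-integral d k j))

𝟙⁺ 𝟙⁻ : ℤ → ℚ
𝟙⁺ +[1+ _ ] = 1ℚ
𝟙⁺ _        = 0ℚ
𝟙⁻ -[1+ _ ] = 1ℚ
𝟙⁻ _        = 0ℚ

0≤1 : 0ℚ ℚ.≤ 1ℚ
0≤1 = *≤* (ℤ.+≤+ z≤n)

𝟙⁺-bounds : ∀ z → 0ℚ ℚ.≤ 𝟙⁺ z × 𝟙⁺ z ℚ.≤ 1ℚ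
𝟙⁺-bounds +[1+ _ ] = 0≤1 , ℚ.≤-refl
𝟙⁺-bounds (+ zero) = ℚ.≤-refl , 0≤1
𝟙⁺-bounds -[1+ _ ] = ℚ.≤-refl , 0≤1

𝟙⁻-bounds : ∀ z → 0ℚ ℚ.≤ 𝟙⁻ z × 𝟙⁻ z ℚ.≤ 1ℚ
𝟙⁻-bounds -[1+ _ ] = 0≤1 , ℚ.≤-refl
𝟙⁻-bounds (+ _)    = ℚ.≤-refl , 0≤1

𝟙⁺-𝟙⁻ : ∀ z → 𝟙⁺ z ℚ.* (z / 1) ℚ.- 𝟙⁻ z ℚ.* (z / 1) ≡ + ℤ.∣ z ∣ / 1
𝟙⁺-𝟙⁻ (+ zero) = refl
𝟙⁺-𝟙⁻ +[1+ n ] = solve 1 (λ x → con 1ℚ :* x :- con 0ℚ :* x := x) refl (+[1+ n ] / 1)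
  where open ℚ-Solver
𝟙⁺-𝟙⁻ -[1+ n ] = solve 1 (λ x → con 0ℚ :* (:- x) :- con 1ℚ :* (:- x) := x) refl (+[1+ n ] / 1)
  where open ℚ-Solver

combination-sign-difference : ∀ {n d} (f : Vecℚ d) (U : Fin n → Vecℚ d) (C : Fin n → ℤ) →
  (∀ k → dot f (U k) ≡ C k / 1) →
  dot f (combination (𝟙⁺ ∘ C) U) ℚ.- dot f (combination (𝟙⁻ ∘ C) U) ≡ + ℓ¹ C / 1
combination-sign-difference {n} f U C f·U≡C = begin
  dot f (combination (𝟙⁺ ∘ C) U) ℚ.- dot f (combination (𝟙⁻ ∘ C) U)
    ≡⟨ cong₂ ℚ._-_ (trans (dot-combination f (𝟙⁺ ∘ C) U) (sumFin≡sum pos))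
                   (trans (dot-combination f (𝟙⁻ ∘ C) U) (sumFin≡sum neg)) ⟩
  Σℚ.sum pos ℚ.- Σℚ.sum neg
    ≡⟨ sum-sub pos neg ⟨
  Σℚ.sum (λ k → pos k ℚ.- neg k)
    ≡⟨ Σℚ.sum-cong-≗ (λ k → trans (cong (λ x → 𝟙⁺ (C k) ℚ.* x ℚ.- 𝟙⁻ (C k) ℚ.* x) (f·U≡C k)) (𝟙⁺-𝟙⁻ (C k))) ⟩
  Σℚ.sum (λ k → + ℤ.∣ C k ∣ / 1)
    ≡⟨ sum-/1 (λ k → + ℤ.∣ C k ∣) ⟩
  Σℤ.sum (λ k → + ℤ.∣ C k ∣) / 1
    ≡⟨ cong (_/ 1) (sum-+ (λ k → ℤ.∣ C k ∣)) ⟩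
  + ℓ¹ C / 1
    ∎
  where
  open ≡-Reasoning
  pos neg : Fin n → ℚ
  pos k = 𝟙⁺ (C k) ℚ.* dot f (U k)
  neg k = 𝟙⁻ (C k) ℚ.* dot f (U k)

module IntegralFunctional {m : ℕ} (f : Vecℚ (suc m)) (integral : IntegralOn (Λ (suc m)) f) where

  C : Fin (suc (suc m)) → ℤ
  C k = proj₁ (integral (gens (suc m) k) (gens∈Λ (suc m) k))

  f·u≡C : ∀ k → dot f (gens (suc m) k) ≡ C k / 1
  f·u≡C k = proj₂ (integral (gens (suc m) k) (gens∈Λ (suc m) k))

  f·w : ℤ
  f·w = proj₁ (integral (wvec (suc m)) w∈Λ)

  ω : Fin (suc (suc m)) → ℤ
  ω k = + weight m (toℕ k)

  sum-init-C≡0 : Σℤ.sum (init C) ≡ + 0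
  sum-init-C≡0 = /1-injective (begin
    Σℤ.sum (init C) / 1                           ≡⟨ sum-/1 (init C) ⟨
    Σℚ.sum (λ k → init C k / 1)                   ≡⟨ Σℚ.sum-cong-≗ (λ k → sym (f·u≡C (inject₁ k))) ⟩
    Σℚ.sum (init (λ k → dot f (gens (suc m) k)))  ≡⟨ sum-init-dot-gens≡0 f ⟩
    0ℚ                                            ∎)
    where open ≡-Reasoning

  weighted-sum-C≡d·f·w : Σℤ.sum (λ k → ω k ℤ.* C k) ≡ + suc m ℤ.* f·w
  weighted-sum-C≡d·f·w = /1-injective (begin
    Σℤ.sum (λ k → ω k ℤ.* C k) / 1
      ≡⟨ sum-/1 (λ k → ω k ℤ.* C k) ⟨
    Σℚ.sum (λ k → (ω k ℤ.* C k) / 1)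
      ≡⟨ Σℚ.sum-cong-≗ (λ k → trans (/1-* (ω k) (C k)) (cong (ω k / 1 ℚ.*_) (sym (f·u≡C k)))) ⟩
    Σℚ.sum (λ k → ω k / 1 ℚ.* dot f (gens (suc m) k))
      ≡⟨ sumFin≡sum (λ k → ω k / 1 ℚ.* dot f (gens (suc m) k)) ⟨
    sumFin (λ k → ω k / 1 ℚ.* dot f (gens (suc m) k))
      ≡⟨ dot-combination f (λ k → ω k / 1) (gens (suc m)) ⟨
    dot f (combination (λ k → ω k / 1) (gens (suc m)))
      ≡⟨ dot-congʳ f combination-weight ⟩
    dot f (λ j → (+ suc m / 1) ℚ.* wvec (suc m) j)
      ≡⟨ dot-scaleʳ f (+ suc m / 1) (wvec (suc m)) ⟩
    (+ suc m / 1) ℚ.* dot f (wvec (suc m))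
      ≡⟨ cong ((+ suc m / 1) ℚ.*_) (proj₂ (integral (wvec (suc m)) w∈Λ)) ⟩
    (+ suc m / 1) ℚ.* (f·w / 1)
      ≡⟨ /1-* (+ suc m) f·w ⟨
    (+ suc m ℤ.* f·w) / 1
      ∎)
    where open ≡-Reasoning

  weighted-sum-C : + suc m ∣ Σℤ.sum (λ k → + weight m (toℕ k) ℤ.* init C k) ℤ.+ last C
  weighted-sum-C = divides f·w (begin
    Σℤ.sum (λ k → + weight m (toℕ k) ℤ.* init C k) ℤ.+ last C
      ≡⟨ cong₂ ℤ._+_ (Σℤ.sum-cong-≗ (λ k → cong (λ a → + weight m a ℤ.* C (inject₁ k)) (sym (Fin.toℕ-inject₁ k))))
                     (sym ωv·Cv≡Cv) ⟩
    Σℤ.sum (init (λ k → ω k ℤ.* C k)) ℤ.+ ω v ℤ.* C v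
      ≡⟨ Σℤ.sum-init-last (λ k → ω k ℤ.* C k) ⟨
    Σℤ.sum (λ k → ω k ℤ.* C k)
      ≡⟨ weighted-sum-C≡d·f·w ⟩
    + suc m ℤ.* f·w
      ≡⟨ ℤ.*-comm (+ suc m) f·w ⟩
    f·w ℤ.* + suc m
      ∎)
    where
    open ≡-Reasoning
    ωv·Cv≡Cv : ω v ℤ.* C v ≡ C v
    ωv·Cv≡Cv = trans (cong (λ a → + weight m a ℤ.* C v) (toℕ-v {m}))
                     (trans (cong (λ a → + a ℤ.* C v) (weight-1+m {m})) (ℤ.*-identityˡ (C v)))

  C≢0 : (∃ λ j → f j ≢ 0ℚ) → ¬ ((∀ k → init C k ≡ + 0) × last C ≡ + 0)
  C≢0 (j , fj≢0) (init≡0 , last≡0) =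
    fj≢0 (dot-gens≡0⇒≡0 f (λ k → trans (f·u≡C k) (cong (_/ 1) (C≡0 k))) j)
    where
    C≡0 : ∀ k → C k ≡ + 0
    C≡0 k with view k
    ... | ‵fromℕ      = last≡0
    ... | ‵inject₁ k′ = init≡0 k′

width≥3 : ∀ m → 2 ℕ.≤ m → LatticeWidthAtLeast (Λ (suc m)) (gens (suc m)) (+ 3 / 1)
width≥3 m 2≤m f f≢0 integral =
  combination (𝟙⁺ ∘ C) (gens (suc m)) , combination (𝟙⁻ ∘ C) (gens (suc m)) ,
  (𝟙⁺ ∘ C , 𝟙⁺-bounds ∘ C , λ _ → refl) , (𝟙⁻ ∘ C , 𝟙⁻-bounds ∘ C , λ _ → refl) ,
  subst (+ 3 / 1 ℚ.≤_) (sym (combination-sign-difference f (gens (suc m)) C f·u≡C)) (/1-mono-≤ (ℤ.+≤+ 3≤ℓ¹C))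
  where
  open IntegralFunctional f integral
  3≤ℓ¹C : 3 ℕ.≤ ℓ¹ C
  3≤ℓ¹C = subst (3 ℕ.≤_) (sym (Σℕ.sum-init-last (λ k → ℤ.∣ C k ∣)))
            (balanced-ℓ¹≥3 {ω = λ j → + weight m (toℕ j)} (s≤s 2≤m) (coordinate-weights-separated m)
                           (init C) (last C) sum-init-C≡0 weighted-sum-C (C≢0 f≢0))

-- κ(Z) = (d − 1)/d

-- The point y = (1/m, 2/m, …, m/m, 1/(2m)) of Z, with m = d − 1, satisfies c + κ(y − c) = w.
module Attained (n : ℕ) where

  m : ℕ
  m = suc n

  μ D Mi κ : ℚ
  μ  = + m / 1
  D  = + 1 / suc m
  Mi = + 1 / m
  κ  = + m / suc m

  μMi≡1 : μ ℚ.* Mi ≡ 1ℚ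
  μMi≡1 = fraction-inverse n

  [1+μ]D≡1 : (1ℚ ℚ.+ μ) ℚ.* D ≡ 1ℚ
  [1+μ]D≡1 = trans (cong (ℚ._* D) (sym (/1-+ (+ 1) (+ m)))) (fraction-inverse m)

  t : Fin (suc (suc m)) → ℚ
  t k with view k
  ... | ‵fromℕ     = ½ ℚ.* Mi
  ... | ‵inject₁ i = (+ weight m (toℕ i) / 1) ℚ.* Mi

  t-inject₁ : ∀ i → t (inject₁ i) ≡ (+ weight m (toℕ i) / 1) ℚ.* Mi
  t-inject₁ i rewrite view-inject₁ i = refl

  t-v : t v ≡ ½ ℚ.* Mi
  t-v rewrite view-fromℕ (suc m) = refl

  scaled-bounds : ∀ {q} → 0ℚ ℚ.≤ q → q ℚ.≤ μ → 0ℚ ℚ.≤ q ℚ.* Mi × q ℚ.* Mi ℚ.≤ 1ℚ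
  scaled-bounds {q} 0≤q q≤μ =
    ℚ.≤-trans (ℚ.≤-reflexive (sym (ℚ.*-zeroˡ Mi))) (ℚ.*-monoʳ-≤-nonNeg Mi {{ℚ.normalize-nonNeg 1 m}} 0≤q) ,
    ℚ.≤-trans (ℚ.*-monoʳ-≤-nonNeg Mi {{ℚ.normalize-nonNeg 1 m}} q≤μ) (ℚ.≤-reflexive μMi≡1)

  t-bounds : ∀ k → 0ℚ ℚ.≤ t k × t k ℚ.≤ 1ℚ
  t-bounds k with view k
  ... | ‵fromℕ     = scaled-bounds {½} (*≤* (ℤ.+≤+ z≤n))
                                       (ℚ.≤-trans {j = 1ℚ} (*≤* (ℤ.+≤+ (s≤s z≤n))) (/1-mono-≤ {+ 1} {+ m} (ℤ.+≤+ (s≤s z≤n))))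
  ... | ‵inject₁ i = scaled-bounds {+ weight m (toℕ i) / 1} (/1-mono-≤ {+ 0} {+ weight m (toℕ i)} (ℤ.+≤+ z≤n))
                                   (/1-mono-≤ {_} {+ m} (ℤ.+≤+ (weight-≤ {m} (ℕ.≤-pred (Fin.toℕ<n i)))))

  scaled-point : ∀ {c c′ y y′ x} → c ≡ c′ → y ≡ y′ → x ≡ c′ ℚ.+ (μ ℚ.* D) ℚ.* (y′ ℚ.- c′) →
                 x ≡ c ℚ.+ κ ℚ.* (y ℚ.- c)
  scaled-point {c} {y = y} refl refl x≡ = trans x≡ (cong (λ k → c ℚ.+ k ℚ.* (y ℚ.- c)) (sym (fraction m m)))

  equation-axis : ∀ j → toℕ j ℕ.< m → wvec (suc m) j ≡
    center (gens (suc m)) j ℚ.+ κ ℚ.* (combination t (gens (suc m)) j ℚ.- center (gens (suc m)) j)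
  equation-axis j j<m = scaled-point (trans (center-gens j) (cong (½ ℚ.*_) (gens-v-axis toℕ-v j<m))) y≡ (begin
    wvec (suc m) j             ≡⟨ trans (wvec-axis j j<m) (fraction (suc (toℕ j)) m) ⟩
    a ℚ.* D                    ≡⟨ ℚ.*-identityʳ (a ℚ.* D) ⟨
    (a ℚ.* D) ℚ.* 1ℚ           ≡⟨ cong ((a ℚ.* D) ℚ.*_) μMi≡1 ⟨
    (a ℚ.* D) ℚ.* (μ ℚ.* Mi)
      ≡⟨ solve 4 (λ a D μ Mi → (a :* D) :* (μ :* Mi) :=
                    con ½ :* con 0ℚ :+ (μ :* D) :* ((a :* Mi :- con 0ℚ :* Mi) :- con ½ :* con 0ℚ)) refl a D μ Mi ⟩
    ½ ℚ.* 0ℚ ℚ.+ (μ ℚ.* D) ℚ.* ((a ℚ.* Mi ℚ.- 0ℚ ℚ.* Mi) ℚ.- ½ ℚ.* 0ℚ)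
      ∎)
    where
    open ≡-Reasoning
    open ℚ-Solver
    a : ℚ
    a = + suc (toℕ j) / 1
    weight-last≡0 : weight m (toℕ (fromℕ m)) ≡ 0
    weight-last≡0 = trans (cong (weight m) (Fin.toℕ-fromℕ m)) weight-m
    y≡ : combination t (gens (suc m)) j ≡ a ℚ.* Mi ℚ.- 0ℚ ℚ.* Mi
    y≡ = trans (combination-axis t j j<m) (cong₂ ℚ._-_
           (trans (t-inject₁ j) (cong (λ w → (+ w / 1) ℚ.* Mi) (weight-< j<m)))
           (trans (t-inject₁ (fromℕ m)) (cong (λ w → (+ w / 1) ℚ.* Mi) weight-last≡0)))

  equation-last : wvec (suc m) (fromℕ m) ≡
    center (gens (suc m)) (fromℕ m) ℚ.+ κ ℚ.* (combination t (gens (suc m)) (fromℕ m) ℚ.- center (gens (suc m)) (fromℕ m))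
  equation-last = scaled-point (trans (center-gens (fromℕ m)) (cong (½ ℚ.*_) (gens-v-last toℕ-v (Fin.toℕ-fromℕ m))))
                               (trans (combination-last t) t-v) (begin
    wvec (suc m) (fromℕ m)
      ≡⟨ wvec-last {m} ⟩
    D
      ≡⟨ solve 2 (λ μ D → D := con ½ :* (con 1ℚ :- con 1ℚ) :+ con ½ :* D :* con 1ℚ :+ con ½ :* D) refl μ D ⟩
    ½ ℚ.* (1ℚ ℚ.- 1ℚ) ℚ.+ ½ ℚ.* D ℚ.* 1ℚ ℚ.+ ½ ℚ.* D
      ≡⟨ cong₂ (λ u w → ½ ℚ.* (1ℚ ℚ.- u) ℚ.+ ½ ℚ.* D ℚ.* w ℚ.+ ½ ℚ.* D) [1+μ]D≡1 μMi≡1 ⟨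
    ½ ℚ.* (1ℚ ℚ.- (1ℚ ℚ.+ μ) ℚ.* D) ℚ.+ ½ ℚ.* D ℚ.* (μ ℚ.* Mi) ℚ.+ ½ ℚ.* D
      ≡⟨ solve 3 (λ μ D Mi → con ½ :* (con 1ℚ :- (con 1ℚ :+ μ) :* D) :+ con ½ :* D :* (μ :* Mi) :+ con ½ :* D
                             := con ½ :* con 1ℚ :+ (μ :* D) :* (con ½ :* Mi :- con ½ :* con 1ℚ)) refl μ D Mi ⟩
    ½ ℚ.* 1ℚ ℚ.+ (μ ℚ.* D) ℚ.* (½ ℚ.* Mi ℚ.- ½ ℚ.* 1ℚ)
      ∎)
    where
    open ≡-Reasoning
    open ℚ-Solver

  equation : ∀ j → wvec (suc m) j ≡
    center (gens (suc m)) j ℚ.+ κ ℚ.* (combination t (gens (suc m)) j ℚ.- center (gens (suc m)) j)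
  equation j with coordinateKind j
  ... | inj₁ j<m  = equation-axis j j<m
  ... | inj₂ refl = equation-last

κ-attained : ∀ n → Σ (Vecℚ (suc (suc n))) λ x →
             Λ (suc (suc n)) x × InScaled (gens (suc (suc n))) (+ suc n / suc (suc n)) x
κ-attained n = wvec (suc m) , w∈Λ , combination t (gens (suc m)) , (t , t-bounds , λ _ → refl) , equation
  where open Attained n

collision⇒∣ : ∀ {d k} {ω : Fin k → ℤ} → Prime d → Separated d ω → ∀ (a : Fin k → ℤ) n {i j} → i ≢ j →
              + d ℤ.* a i ℤ.+ n ℤ.* ω i ≡ + d ℤ.* a j ℤ.+ n ℤ.* ω j → + d ∣ n
collision⇒∣ {d} {ω = ω} d-prime separated a n {i} {j} i≢j eq =
  [ (λ d∣n → d∣n) , (λ d∣ωi-ωj → contradiction (separated i j d∣ωi-ωj) i≢j) ]′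
  (prime-∣-* d-prime n (ω i ℤ.- ω j) (divides (a j ℤ.- a i) n[ωi-ωj]≡))
  where
  open ≡-Reasoning
  open ℤ-Solver
  n[ωi-ωj]≡ : n ℤ.* (ω i ℤ.- ω j) ≡ (a j ℤ.- a i) ℤ.* + d
  n[ωi-ωj]≡ = begin
    n ℤ.* (ω i ℤ.- ω j)
      ≡⟨ solve 3 (λ n x y → n :* (x :- y) := n :* x :- n :* y) refl n (ω i) (ω j) ⟩
    n ℤ.* ω i ℤ.- n ℤ.* ω j
      ≡⟨ solve 4 (λ u w x d → u :- w := (d :* x :+ u) :- (d :* x :+ w)) refl (n ℤ.* ω i) (n ℤ.* ω j) (a i) (+ d) ⟩
    (+ d ℤ.* a i ℤ.+ n ℤ.* ω i) ℤ.- (+ d ℤ.* a i ℤ.+ n ℤ.* ω j)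
      ≡⟨ cong (ℤ._- (+ d ℤ.* a i ℤ.+ n ℤ.* ω j)) eq ⟩
    (+ d ℤ.* a j ℤ.+ n ℤ.* ω j) ℤ.- (+ d ℤ.* a i ℤ.+ n ℤ.* ω j)
      ≡⟨ solve 4 (λ w x y d → (d :* y :+ w) :- (d :* x :+ w) := (y :- x) :* d) refl (n ℤ.* ω j) (a i) (a j) (+ d) ⟩
    (a j ℤ.- a i) ℤ.* + d
      ∎

module Minimality {m : ℕ} (d-prime : Prime (suc m)) {λ′ : ℚ} (0≤λ : 0ℚ ℚ.≤ λ′) (λ<κ : λ′ ℚ.< + m / suc m)
                  {x : Vecℚ (suc m)} (z : Fin (suc m) → ℤ) (n : ℤ)
                  (x≡z+nw : ∀ j → x j ≡ z j / 1 ℚ.+ (n / 1) ℚ.* wvec (suc m) j)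
                  (t : Fin (suc (suc m)) → ℚ) (t∈[0,1] : ∀ k → 0ℚ ℚ.≤ t k × t k ℚ.≤ 1ℚ)
                  (x≡c+λ[y-c] : ∀ j → x j ≡ center (gens (suc m)) j ℚ.+
                                          λ′ ℚ.* (combination t (gens (suc m)) j ℚ.- center (gens (suc m)) j))
                  where

  δ D μ : ℚ
  δ = + suc m / 1
  D = + 1 / suc m
  μ = + m / 1

  c y : Vecℚ (suc m)
  c = center (gens (suc m))
  y = combination t (gens (suc m))

  T : Fin (suc m) → ℚ
  T j = t (inject₁ j) ℚ.- t ud

  x-axis : ∀ j → toℕ j ℕ.< m → x j ≡ λ′ ℚ.* T j
  x-axis j j<m = begin
    x j                                     ≡⟨ x≡c+λ[y-c] j ⟩
    c j ℚ.+ λ′ ℚ.* (y j ℚ.- c j)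
      ≡⟨ cong₂ (λ c′ y′ → c′ ℚ.+ λ′ ℚ.* (y′ ℚ.- c′))
               (trans (center-gens j) (cong (½ ℚ.*_) (gens-v-axis toℕ-v j<m))) (combination-axis t j j<m) ⟩
    ½ ℚ.* 0ℚ ℚ.+ λ′ ℚ.* (T j ℚ.- ½ ℚ.* 0ℚ)
      ≡⟨ solve 2 (λ l a → con ½ :* con 0ℚ :+ l :* (a :- con ½ :* con 0ℚ) := l :* a) refl λ′ (T j) ⟩
    λ′ ℚ.* T j                              ∎
    where
    open ≡-Reasoning
    open ℚ-Solver

  x-last : x (fromℕ m) ≡ ½ ℚ.+ λ′ ℚ.* (t v ℚ.- ½)
  x-last = begin
    x (fromℕ m)                                         ≡⟨ x≡c+λ[y-c] (fromℕ m) ⟩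
    c (fromℕ m) ℚ.+ λ′ ℚ.* (y (fromℕ m) ℚ.- c (fromℕ m))
      ≡⟨ cong₂ (λ c′ y′ → c′ ℚ.+ λ′ ℚ.* (y′ ℚ.- c′))
               (trans (center-gens (fromℕ m)) (cong (½ ℚ.*_) (gens-v-last toℕ-v (Fin.toℕ-fromℕ m))))
               (combination-last t) ⟩
    ½ ℚ.* 1ℚ ℚ.+ λ′ ℚ.* (t v ℚ.- ½ ℚ.* 1ℚ)
      ≡⟨ cong₂ (λ a b → a ℚ.+ λ′ ℚ.* (t v ℚ.- b)) (ℚ.*-identityʳ ½) (ℚ.*-identityʳ ½) ⟩
    ½ ℚ.+ λ′ ℚ.* (t v ℚ.- ½)                            ∎
    where open ≡-Reasoning

  z′ : Fin (suc m) → ℤ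
  z′ j with toℕ j <? m
  ... | yes _ = z j
  ... | no  _ = + 0

  z′-axis : ∀ j → toℕ j ℕ.< m → z′ j ≡ z j
  z′-axis j j<m with toℕ j <? m
  ... | yes _   = refl
  ... | no  j≮m = contradiction j<m j≮m

  z′-last : z′ (fromℕ m) ≡ + 0
  z′-last with toℕ (fromℕ m) <? m
  ... | yes m<m = contradiction (subst (ℕ._< m) (Fin.toℕ-fromℕ m) m<m) (ℕ.<-irrefl refl)
  ... | no  _   = refl

  ω : Fin (suc m) → ℤ
  ω j = + weight m (toℕ j)

  -- N j = d·x_j for j < m and N m = 0; as N j = dλ(t_j − t_m), all N j lie in an interval of length dλ < m.
  N : Fin (suc m) → ℤ
  N j = + suc m ℤ.* z′ j ℤ.+ n ℤ.* ω j

  N≡δλT : ∀ j → N j / 1 ≡ δ ℚ.* (λ′ ℚ.* T j)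
  N≡δλT j with coordinateKind j
  ... | inj₁ j<m = begin
    N j / 1
      ≡⟨ trans (/1-+ (+ suc m ℤ.* z′ j) (n ℤ.* ω j)) (cong₂ ℚ._+_ (/1-* (+ suc m) (z′ j)) (/1-* n (ω j))) ⟩
    δ ℚ.* (z′ j / 1) ℚ.+ (n / 1) ℚ.* (ω j / 1)
      ≡⟨ cong₂ (λ u w → δ ℚ.* (u / 1) ℚ.+ (n / 1) ℚ.* (+ w / 1)) (z′-axis j j<m) (weight-< j<m) ⟩
    δ ℚ.* (z j / 1) ℚ.+ (n / 1) ℚ.* a
      ≡⟨ cong (δ ℚ.* (z j / 1) ℚ.+_) (ℚ.*-identityʳ _) ⟨
    δ ℚ.* (z j / 1) ℚ.+ (n / 1) ℚ.* a ℚ.* 1ℚ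
      ≡⟨ cong (λ e → δ ℚ.* (z j / 1) ℚ.+ (n / 1) ℚ.* a ℚ.* e) (fraction-inverse m) ⟨
    δ ℚ.* (z j / 1) ℚ.+ (n / 1) ℚ.* a ℚ.* (δ ℚ.* D)
      ≡⟨ solve 5 (λ δ Z N a D → δ :* Z :+ N :* a :* (δ :* D) := δ :* (Z :+ N :* (a :* D))) refl δ (z j / 1) (n / 1) a D ⟩
    δ ℚ.* (z j / 1 ℚ.+ (n / 1) ℚ.* (a ℚ.* D))
      ≡⟨ cong (λ w → δ ℚ.* (z j / 1 ℚ.+ (n / 1) ℚ.* w)) (trans (wvec-axis j j<m) (fraction (suc (toℕ j)) m)) ⟨
    δ ℚ.* (z j / 1 ℚ.+ (n / 1) ℚ.* wvec (suc m) j)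
      ≡⟨ cong (δ ℚ.*_) (trans (sym (x≡z+nw j)) (x-axis j j<m)) ⟩
    δ ℚ.* (λ′ ℚ.* T j)
      ∎
    where
    open ≡-Reasoning
    open ℚ-Solver
    a : ℚ
    a = + suc (toℕ j) / 1
  ... | inj₂ refl = begin
    N (fromℕ m) / 1
      ≡⟨ cong₂ (λ u w → (+ suc m ℤ.* u ℤ.+ n ℤ.* + w) / 1) z′-last (trans (cong (weight m) (Fin.toℕ-fromℕ m)) weight-m) ⟩
    (+ suc m ℤ.* + 0 ℤ.+ n ℤ.* + 0) / 1
      ≡⟨ cong (_/ 1) (cong₂ ℤ._+_ (ℤ.*-zeroʳ (+ suc m)) (ℤ.*-zeroʳ n)) ⟩
    0ℚ
      ≡⟨ solve 3 (λ δ l a → con 0ℚ := δ :* (l :* (a :- a))) refl δ λ′ (t ud) ⟩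
    δ ℚ.* (λ′ ℚ.* T (fromℕ m))
      ∎
    where
    open ≡-Reasoning
    open ℚ-Solver

  N-close : ∀ i j → N i ℤ.- N j ℤ.< + m
  N-close i j = /1-cancel-< (begin-strict
    (N i ℤ.- N j) / 1
      ≡⟨ trans (/1-+ (N i) (ℤ.- N j)) (cong (N i / 1 ℚ.+_) (/1-neg (N j))) ⟩
    N i / 1 ℚ.- N j / 1
      ≡⟨ cong₂ ℚ._-_ (N≡δλT i) (N≡δλT j) ⟩
    δ ℚ.* (λ′ ℚ.* T i) ℚ.- δ ℚ.* (λ′ ℚ.* T j)
      ≡⟨ solve 5 (λ δ l a b c → δ :* (l :* (a :- c)) :- δ :* (l :* (b :- c)) := δ :* (l :* (a :- b))) refl
                 δ λ′ (t (inject₁ i)) (t (inject₁ j)) (t ud) ⟩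
    δ ℚ.* (λ′ ℚ.* (t (inject₁ i) ℚ.- t (inject₁ j)))
      ≤⟨ ℚ.*-monoˡ-≤-nonNeg δ {{ℚ.normalize-nonNeg (suc m) 1}} (ℚ.*-monoˡ-≤-nonNeg λ′ {{ℚ.nonNegative 0≤λ}} Δt≤1) ⟩
    δ ℚ.* (λ′ ℚ.* 1ℚ)     ≡⟨ cong (δ ℚ.*_) (ℚ.*-identityʳ λ′) ⟩
    δ ℚ.* λ′              <⟨ ℚ.*-monoʳ-<-pos δ {{ℚ.normalize-pos (suc m) 1}} λ<κ ⟩
    δ ℚ.* (+ m / suc m)   ≡⟨ cong (δ ℚ.*_) (fraction m m) ⟩
    δ ℚ.* (μ ℚ.* D)       ≡⟨ solve 3 (λ δ μ D → δ :* (μ :* D) := μ :* (δ :* D)) refl δ μ D ⟩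
    μ ℚ.* (δ ℚ.* D)       ≡⟨ cong (μ ℚ.*_) (fraction-inverse m) ⟩
    μ ℚ.* 1ℚ              ≡⟨ ℚ.*-identityʳ μ ⟩
    μ                     ∎)
    where
    open ℚ.≤-Reasoning
    open ℚ-Solver
    Δt≤1 : t (inject₁ i) ℚ.- t (inject₁ j) ℚ.≤ 1ℚ
    Δt≤1 = ℚ.+-mono-≤ (proj₂ (t∈[0,1] (inject₁ i))) (ℚ.neg-antimono-≤ (proj₁ (t∈[0,1] (inject₁ j))))

  d∣n : + suc m ∣ n
  d∣n = collision⇒∣ {ω = ω} d-prime (coordinate-weights-separated m) z′ n
                    (proj₁ (proj₂ (proj₂ collision))) (proj₂ (proj₂ (proj₂ collision)))
    where
    collision : ∃ λ i → ∃ λ j → i ≢ j × N i ≡ N j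
    collision = short-range-collision N N-close

  q : ℤ
  q = _∣_.quotient d∣n

  x-last-integral : x (fromℕ m) ≡ (z (fromℕ m) ℤ.+ q) / 1
  x-last-integral = begin
    x (fromℕ m)
      ≡⟨ x≡z+nw (fromℕ m) ⟩
    z (fromℕ m) / 1 ℚ.+ (n / 1) ℚ.* wvec (suc m) (fromℕ m)
      ≡⟨ cong₂ (λ a w → z (fromℕ m) / 1 ℚ.+ (a / 1) ℚ.* w) (_∣_.equality d∣n) (wvec-last {m}) ⟩
    z (fromℕ m) / 1 ℚ.+ ((q ℤ.* + suc m) / 1) ℚ.* D
      ≡⟨ cong (λ a → z (fromℕ m) / 1 ℚ.+ a ℚ.* D) (/1-* q (+ suc m)) ⟩
    z (fromℕ m) / 1 ℚ.+ (q / 1) ℚ.* δ ℚ.* D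
      ≡⟨ cong (z (fromℕ m) / 1 ℚ.+_) (trans (ℚ.*-assoc (q / 1) δ D)
                                            (trans (cong ((q / 1) ℚ.*_) (fraction-inverse m)) (ℚ.*-identityʳ (q / 1)))) ⟩
    z (fromℕ m) / 1 ℚ.+ q / 1
      ≡⟨ /1-+ (z (fromℕ m)) q ⟨
    (z (fromℕ m) ℤ.+ q) / 1
      ∎
    where open ≡-Reasoning

  impossible : ⊥
  impossible = no-integer-strictly-between-0-1 (z (fromℕ m) ℤ.+ q)
    (subst (0ℚ ℚ.<_) x-last≡ (proj₁ 0<x-last<1)) (subst (ℚ._< 1ℚ) x-last≡ (proj₂ 0<x-last<1))
    where
    x-last≡ : ½ ℚ.+ λ′ ℚ.* (t v ℚ.- ½) ≡ (z (fromℕ m) ℤ.+ q) / 1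
    x-last≡ = trans (sym x-last) x-last-integral
    0<x-last<1 : 0ℚ ℚ.< ½ ℚ.+ λ′ ℚ.* (t v ℚ.- ½) × ½ ℚ.+ λ′ ℚ.* (t v ℚ.- ½) ℚ.< 1ℚ
    0<x-last<1 = shrink-toward-½ 0≤λ (ℚ.<-trans λ<κ (m/[1+m]<1 m)) (proj₁ (t∈[0,1] v)) (proj₂ (t∈[0,1] v))

κ-minimal : ∀ m → Prime (suc m) → ∀ λ′ → 0ℚ ℚ.≤ λ′ → λ′ ℚ.< + m / suc m →
            ¬ (Σ (Vecℚ (suc m)) λ x → Λ (suc m) x × InScaled (gens (suc m)) λ′ x)
κ-minimal m d-prime λ′ 0≤λ λ<κ (x , (z , n , x≡z+nw) , y , (t , t∈[0,1] , y≡Σtu) , x≡c+λ[y-c]) =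
  Minimality.impossible d-prime 0≤λ λ<κ z n x≡z+nw t t∈[0,1] (λ j →
    trans (x≡c+λ[y-c] j) (cong (λ w → center (gens (suc m)) j ℚ.+ λ′ ℚ.* (w ℚ.- center (gens (suc m)) j)) (y≡Σtu j)))

proposition3p13 : (d : ℕ) → .{{_ : NonZero d}} → Prime d → 2 < d →
    (∀ k → IsColoop (gens d) k ⇔ toℕ k ≡ d)
    × LatticeWidthAtLeast (Λ d) (gens d) (+ 3 / 1)
    × IsKappa (Λ d) (gens d) (+ (d ∸ 1) / d)
    × (+ d / suc (suc d)) ℚ.< (+ (d ∸ 1) / d)
proposition3p13 (suc m@(suc (suc k))) d-prime (s≤s 2≤m@(s≤s (s≤s z≤n))) =
  coloop⇔v ,
  width≥3 m 2≤m ,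
  (ℚ.nonNegative⁻¹ _ {{ℚ.normalize-nonNeg m (suc m)}} , κ-attained (suc k) , κ-minimal m d-prime) ,
  [1+m]/[3+m]<m/[1+m] m 2≤m
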